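{- Let $G$ be a finite abelian group of order $r$ and exponent greater than $2$. Let $\mathcal{S}$ be the set of inverse-closed subsets of $G$ and $\mathcal{S}_1$ the set of $S\in\mathcal{S}$ such that $\mathrm{Cay}(G,S)$ is connected, non-bipartite and twin-free. Then $|\mathcal{S}-\mathcal{S}_1|/|\mathcal{S}|\le 2^{ -r/6+(\log_2r)^2+2}$.
   Context: $\mathrm{Cay}(G,S)$ has vertex set $G$, with $x\sim y$ iff $yx^{ -1}\in S$ (loops occur if $1\in S$). A graph is twin-free if no two distinct vertices have the same neighbourhood. -}

module Defs where

open import Data.Nat using (ℕ; zero; suc; _+_; _*_; _^_; _<_; _≤_)
open import Data.Fin using (Fin)
open import Data.Bool using (Bool; true; false)
open import Data.Vec using (Vec; []; _∷_)
open import Data.List using (List; []; _∷_; map; _++_; length; filter)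
open import Data.Fin.Subset using (Subset; _∈_)
open import Data.Product using (Σ; ∃; _×_; _,_)
open import Relation.Nullary using (¬_)
open import Relation.Unary using (Pred; Decidable)
open import Relation.Binary.PropositionalEquality using (_≡_; _≢_)
open import Relation.Binary.Construct.Closure.ReflexiveTransitive using (Star)
open import Algebra.Structures using (IsAbelianGroup)
open import Level using (0ℓ)

-- A finite abelian group of order r, presented on the carrier Fin r
-- (every group of order r is isomorphic to such a one).
record FinAbGroup (r : ℕ) : Set where
  field
    _∙_ : Fin r → Fin r → Fin r
    ε   : Fin r
    _⁻¹ : Fin r → Fin r
    isAbelianGroup : IsAbelianGroup _≡_ _∙_ ε _⁻¹

module _ {r : ℕ} (G : FinAbGroup r) where
  open FinAbGroup G

  pow : Fin r → ℕ → Fin r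
  pow g zero    = ε
  pow g (suc n) = g ∙ pow g n

  IsExponent : ℕ → Set
  IsExponent e = (0 < e) × (∀ g → pow g e ≡ ε)
               × (∀ m → 0 < m → (∀ g → pow g m ≡ ε) → e ≤ m)

  InverseClosed : Subset r → Set
  InverseClosed S = ∀ x → x ∈ S → (x ⁻¹) ∈ S

  Adj : Subset r → Fin r → Fin r → Set
  Adj S x y = (y ∙ (x ⁻¹)) ∈ S

  Connected : Subset r → Set
  Connected S = ∀ x y → Star (Adj S) x y

  Bipartite : Subset r → Set
  Bipartite S = Σ (Fin r → Bool) λ c → ∀ x y → Adj S x y → c x ≢ c y

  TwinFree : Subset r → Set
  TwinFree S = ∀ x y → (∀ z → (Adj S x z → Adj S y z) × (Adj S y z → Adj S x z)) → x ≡ y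

  Good : Subset r → Set
  Good S = InverseClosed S × Connected S × ¬ Bipartite S × TwinFree S

allSubsets : ∀ n → List (Subset n)
allSubsets zero    = [] ∷ []
allSubsets (suc n) = map (true ∷_) (allSubsets n) ++ map (false ∷_) (allSubsets n)

count : ∀ {n} {P : Pred (Subset n) 0ℓ} → Decidable P → ℕ
count {n} P? = length (filter P? (allSubsets n))

-- RatioBound r A B  expresses the real inequality
--    A / B ≤ 2 ^ (- r/6 + (log₂ r)² + 2)
-- using naturals only.  With t = log₂ r ≥ 0 and c = log₂(A⁶ 2^r / (2¹² B⁶)) / 6,
-- the inequality is t² ≥ c, which holds iff every rational a = p/q > t
-- (i.e. r^q < 2^p) satisfies a² > c, i.e.
--    A^(6q²) · 2^(r q²) < 2^(6p²) · 4096^(q²) · B^(6q²).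
RatioBound : ℕ → ℕ → ℕ → Set
RatioBound r A B =
  ∀ p q → 1 ≤ q → r ^ q < 2 ^ p →
    A ^ (6 * (q * q)) * 2 ^ (r * (q * q))
      < 2 ^ (6 * (p * p)) * 4096 ^ (q * q) * B ^ (6 * (q * q))

-- Let R contain one element of each inverse pair {x, x⁻¹}. An inverse-closed set is
-- determined by its trace on R, so there are 2 ^ |R| of them. If Cay(G,S) is disconnected,
-- bipartite or has twins, then S lies in one of at most 4 r ^ L families, L = ⌊log₂ r⌋:
-- S ⊆ ⟨v⟩ for a proper subgroup generated by a vector v of length L; or S avoids the
-- subgroup ⟨v⟩ = ⟨S S⟩ of index ≤ 2; or S is periodic under h = x y⁻¹ ≠ ε for twins x, y.
-- Every subgroup is generated by L elements, since a new generator at least doubles it.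
-- In each family the sets are determined by their trace on R outside a set of at least
-- r/6 points of R, so the family has at most 2 ^ (|R| - r/6) members. Altogether
-- #bad · 2 ^ (r/6) ≤ 4 r ^ L · #inverse-closed, which is the claim.

module Submission where

open import Defs
open import Algebra.Bundles using (AbelianGroup)
open import Data.Bool using (Bool; true; false)
open import Data.Bool.Properties using (¬-not)
open import Data.Empty using (⊥-elim)
open import Data.Fin using (Fin; zero; suc)
import Data.Fin as Fin
import Data.Fin.Induction as Fin
import Data.Fin.Properties as Fin
open import Data.Fin.Properties using (injective⇒≤; all?; any?; ¬∀⟶∃¬; ¬Fin0)
open import Data.Fin.Subset using (Subset; _∈_)
open import Data.Fin.Subset.Properties using (_∈?_)
import Data.Fin.Subset.Properties as Subsetₚ
open import Data.List using (List; []; _∷_; map; _++_; length; filter; allFin)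
import Data.List as List
open import Data.List.Membership.Propositional using () renaming (_∈_ to _∈ₗ_)
open import Data.List.Membership.Propositional.Properties
  using (∈-map⁺; ∈-map⁻; ∈-lookup; ∈-filter⁺; ∈-filter⁻; ∈-allFin; ∈-++⁺ˡ; ∈-++⁺ʳ; ∈-++⁻)
open import Data.List.Properties
  using (filter-some; filter-all; filter-none; filter-≐; map-tabulate; length-tabulate; length-++; length-map;
         filter-++; filter-accept; filter-reject; length-filter)
open import Data.List.Relation.Unary.All as All using (All; []; _∷_)
open import Data.List.Relation.Unary.AllPairs using ([]; _∷_)
open import Data.List.Relation.Unary.Any as Any using (Any)
open import Data.List.Relation.Unary.Any.Properties using (¬Any[]; cartesianProductWith⁺; lookup-index)
open import Data.List.Relation.Unary.Unique.Propositional using (Unique)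
import Data.List.Relation.Unary.Unique.Propositional.Properties as Unique
open import Data.Nat using (ℕ; zero; suc; _+_; _*_; _^_; _<_; _>_; _≤_; _≤?_; _<?_; z≤n; s≤s; s≤s⁻¹; >-nonZero)
open import Data.Nat.DivMod using (_/_; _%_; m≡m%n+[m/n]*n; m%n<n; m<n*o⇒m/o<n)
open import Data.Nat.ListAction using (sum)
open import Data.Nat.Properties
open import Data.Nat.Tactic.RingSolver using (solve-∀)
open import Data.Product using (Σ; Σ-syntax; ∃-syntax; _×_; _,_; proj₁; proj₂)
open import Data.Sum using (_⊎_; inj₁; inj₂; [_,_]′)
open import Data.Unit using (tt)
open import Data.Vec using (Vec; lookup; _∷_; []; here; there)
open import Data.Vec.Properties using (∷-injectiveʳ)
open import Function using (id; _∘_)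
open import Induction.WellFounded using (Acc; acc)
open import Level using (0ℓ)
open import Relation.Binary using (Rel) renaming (Decidable to Decidable₂)
open import Relation.Binary.Construct.Closure.ReflexiveTransitive as Star using (Star; _◅_; _◅◅_)
open import Relation.Binary.PropositionalEquality
open import Relation.Nullary using (¬_; ¬?; Dec; yes; no; does; contradiction; _→-dec_; _×-dec_; _⊎-dec_)
open import Relation.Nullary.Decidable using (map′; decidable-stable; toSum)
open import Relation.Unary using (Pred; Decidable; U; ∁; _≐_; _⊆_; _∪_; _∩_; _∖_; _⊥_)
open import Relation.Unary.Properties using (_∩?_; _∪?_; ∁?)
open import Algebra.Properties.CommutativeSemigroup *-commutativeSemigroup using () renaming (interchange to *-interchange)

lookup-injective : ∀ {a} {A : Set a} {xs : List A} → Unique xs →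
                   ∀ i j → List.lookup xs i ≡ List.lookup xs j → i ≡ j
lookup-injective (_ ∷ _)        zero    zero    _  = refl
lookup-injective (x∉xs ∷ _)     zero    (suc j) eq = ⊥-elim (All.lookup x∉xs (∈-lookup j) eq)
lookup-injective (x∉xs ∷ _)     (suc i) zero    eq = ⊥-elim (All.lookup x∉xs (∈-lookup i) (sym eq))
lookup-injective (_ ∷ unique) (suc i) (suc j) eq = cong suc (lookup-injective unique i j eq)

length-≤-injection : ∀ {a b} {A : Set a} {B : Set b} {xs : List A} {ys : List B} →
  Unique xs → (f : A → B) → (∀ {x} → x ∈ₗ xs → f x ∈ₗ ys) →
  (∀ {x y} → x ∈ₗ xs → y ∈ₗ xs → f x ≡ f y → x ≡ y) → length xs ≤ length ys
length-≤-injection {xs = xs} {ys} unique f into injective = injective⇒≤ index-injective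
  where
  index : Fin (length xs) → Fin (length ys)
  index i = Any.index (into (∈-lookup i))

  index-injective : ∀ {i j} → index i ≡ index j → i ≡ j
  index-injective {i} {j} eq = lookup-injective unique i j (injective (∈-lookup i) (∈-lookup j) (begin
    f (List.lookup xs i)        ≡⟨ lookup-index (into (∈-lookup i)) ⟩
    List.lookup ys (index i)    ≡⟨ cong (List.lookup ys) eq ⟩
    List.lookup ys (index j)    ≡⟨ lookup-index (into (∈-lookup j)) ⟨
    f (List.lookup xs j)        ∎))
    where open ≡-Reasoning

length-≤-⊆ : ∀ {a} {A : Set a} {xs ys : List A} → Unique xs → (∀ {x} → x ∈ₗ xs → x ∈ₗ ys) → length xs ≤ length ys
length-≤-⊆ unique into = length-≤-injection unique id into (λ _ _ eq → eq)

length-filter-map : ∀ {a b} {A : Set a} {B : Set b} {P : Pred B 0ℓ} (P? : Decidable P) (f : A → B) xs →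
                    length (filter P? (map f xs)) ≡ length (filter (P? ∘ f) xs)
length-filter-map P? f []       = refl
length-filter-map P? f (x ∷ xs) with P? (f x)
... | yes _ = cong suc (length-filter-map P? f xs)
... | no _  = length-filter-map P? f xs

sum-map-*-≤ : ∀ {I : Set} (a : I → ℕ) {k M} → (∀ i → a i * k ≤ M) → ∀ is → sum (map a is) * k ≤ length is * M
sum-map-*-≤ a bound []       = z≤n
sum-map-*-≤ a {k} bound (i ∷ is) = begin
  (a i + sum (map a is)) * k         ≡⟨ *-distribʳ-+ k (a i) _ ⟩
  a i * k + sum (map a is) * k       ≤⟨ +-mono-≤ (bound i) (sum-map-*-≤ a bound is) ⟩
  _ + length is * _                  ∎
  where open ≤-Reasoning

module Counting {A : Set} (universe : List A) (universe-unique : Unique universe) (∈-universe : ∀ x → x ∈ₗ universe) where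

  module _ {P : Pred A 0ℓ} (P? : Decidable P) where

    elements : List A
    elements = filter P? universe

    ∣_∣ : ℕ
    ∣_∣ = length elements

    ∈-elements⁺ : ∀ {x} → P x → x ∈ₗ elements
    ∈-elements⁺ {x} = ∈-filter⁺ P? (∈-universe x)

    ∈-elements⁻ : ∀ {x} → x ∈ₗ elements → P x
    ∈-elements⁻ x∈ = proj₂ (∈-filter⁻ P? {xs = universe} x∈)

    elements-unique : Unique elements
    elements-unique = Unique.filter⁺ P? universe-unique

    ∣∣-≤-injection : ∀ {B : Set} {ys : List B} {Q : Pred B 0ℓ} (Q? : Decidable Q) → (∀ y → y ∈ₗ ys) →
      (f : A → B) → (∀ {x} → P x → Q (f x)) → (∀ {x y} → P x → P y → f x ≡ f y → x ≡ y) →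
      ∣_∣ ≤ length (filter Q? ys)
    ∣∣-≤-injection Q? ∈-ys f PQ injective = length-≤-injection elements-unique f
      (λ x∈ → ∈-filter⁺ Q? (∈-ys _) (PQ (∈-elements⁻ x∈)))
      (λ x∈ y∈ → injective (∈-elements⁻ x∈) (∈-elements⁻ y∈))

    ∣∣>0 : ∀ {x} → P x → ∣_∣ > 0
    ∣∣>0 {x} Px = filter-some P? (Any.map (λ { refl → Px }) (∈-universe x))

    ∣∣≡0 : (∀ x → ¬ P x) → ∣_∣ ≡ 0
    ∣∣≡0 ¬P = cong length (filter-none P? {xs = universe} (All.tabulate (λ {x} _ → ¬P x)))

  module _ {P Q R : Pred A 0ℓ} (P? : Decidable P) (Q? : Decidable Q) (R? : Decidable R) where

    ∣∣-≤-∪ : P ⊆ Q ∪ R → ∣ P? ∣ ≤ ∣ Q? ∣ + ∣ R? ∣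
    ∣∣-≤-∪ P⊆Q∪R = ≤-trans (length-≤-⊆ (elements-unique P?) into) (≤-reflexive (length-++ (elements Q?)))
      where
      into : ∀ {x} → x ∈ₗ elements P? → x ∈ₗ elements Q? ++ elements R?
      into x∈ with P⊆Q∪R (∈-elements⁻ P? x∈)
      ... | inj₁ Qx = ∈-++⁺ˡ (∈-elements⁺ Q? Qx)
      ... | inj₂ Rx = ∈-++⁺ʳ (elements Q?) (∈-elements⁺ R? Rx)

    ∣∣+∣∣-≤-disjoint : P ⊆ R → Q ⊆ R → P ⊥ Q → ∣ P? ∣ + ∣ Q? ∣ ≤ ∣ R? ∣
    ∣∣+∣∣-≤-disjoint P⊆R Q⊆R P⊥Q = ≤-trans (≤-reflexive (sym (length-++ (elements P?))))
      (length-≤-⊆ (Unique.++⁺ (elements-unique P?) (elements-unique Q?) disjoint) into)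
      where
      disjoint : ∀ {x} → ¬ (x ∈ₗ elements P? × x ∈ₗ elements Q?)
      disjoint (x∈P , x∈Q) = P⊥Q (∈-elements⁻ P? x∈P , ∈-elements⁻ Q? x∈Q)
      into : ∀ {x} → x ∈ₗ elements P? ++ elements Q? → x ∈ₗ elements R?
      into x∈ with ∈-++⁻ (elements P?) x∈
      ... | inj₁ x∈P = ∈-elements⁺ R? (P⊆R (∈-elements⁻ P? x∈P))
      ... | inj₂ x∈Q = ∈-elements⁺ R? (Q⊆R (∈-elements⁻ Q? x∈Q))

  module _ {P Q : Pred A 0ℓ} (P? : Decidable P) (Q? : Decidable Q) where

    ⊆⇒∣∣≤ : P ⊆ Q → ∣ P? ∣ ≤ ∣ Q? ∣
    ⊆⇒∣∣≤ P⊆Q = length-≤-⊆ (elements-unique P?) (λ x∈ → ∈-elements⁺ Q? (P⊆Q (∈-elements⁻ P? x∈)))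

    ≐⇒∣∣≡ : P ≐ Q → ∣ P? ∣ ≡ ∣ Q? ∣
    ≐⇒∣∣≡ P≐Q = cong length (filter-≐ P? Q? P≐Q universe)

    ⊂⇒∣∣< : P ⊆ Q → ∀ {x} → Q x → ¬ P x → ∣ P? ∣ < ∣ Q? ∣
    ⊂⇒∣∣< P⊆Q {x} Qx ¬Px = length-≤-⊆ {xs = x ∷ elements P?}
      (All.tabulate (λ y∈ x≡y → ¬Px (subst P (sym x≡y) (∈-elements⁻ P? y∈))) ∷ elements-unique P?)
      λ { (Any.here refl) → ∈-elements⁺ Q? Qx ; (Any.there y∈) → ∈-elements⁺ Q? (P⊆Q (∈-elements⁻ P? y∈)) }

    ∣∣-≤-two-to-one : ∀ {T : Pred A 0ℓ} (T? : Decidable T) (f : A → A) → (∀ {x} → P x → Q (f x)) →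
                      (∀ {x y} → (P ∩ T) x → (P ∩ T) y → f x ≡ f y → x ≡ y) →
                      (∀ {x y} → (P ∖ T) x → (P ∖ T) y → f x ≡ f y → x ≡ y) → ∣ P? ∣ ≤ ∣ Q? ∣ + ∣ Q? ∣
    ∣∣-≤-two-to-one {T} T? f PQ injective-in injective-out = begin
      ∣ P? ∣                          ≤⟨ ∣∣-≤-∪ P? (P? ∩? T?) (P? ∩? ∁? T?) split ⟩
      ∣ P? ∩? T? ∣ + ∣ P? ∩? ∁? T? ∣  ≤⟨ +-mono-≤ (∣∣-≤-injection (P? ∩? T?) Q? ∈-universe f (PQ ∘ proj₁) injective-in)
                                                  (∣∣-≤-injection (P? ∩? ∁? T?) Q? ∈-universe f (PQ ∘ proj₁) injective-out) ⟩
      ∣ Q? ∣ + ∣ Q? ∣                 ∎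
      where
      open ≤-Reasoning
      split : P ⊆ (P ∩ T) ∪ (P ∖ T)
      split {x} Px with T? x
      ... | yes Tx = inj₁ (Px , Tx)
      ... | no ¬Tx = inj₂ (Px , ¬Tx)

  ∣∣-≤-sum : ∀ {I : Set} {P : Pred A 0ℓ} (P? : Decidable P) {Q : I → Pred A 0ℓ} (Q? : ∀ i → Decidable (Q i)) is →
             (∀ {x} → P x → Any (λ i → Q i x) is) → ∣ P? ∣ ≤ sum (map (λ i → ∣ Q? i ∣) is)
  ∣∣-≤-sum P? Q? []       covered = ≤-reflexive (∣∣≡0 P? (λ x Px → ¬Any[] (covered Px)))
  ∣∣-≤-sum {P = P} P? {Q} Q? (i ∷ is) covered = begin
    ∣ P? ∣                                           ≤⟨ ∣∣-≤-∪ P? (Q? i) rest? split ⟩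
    ∣ Q? i ∣ + ∣ rest? ∣                             ≤⟨ +-monoʳ-≤ ∣ Q? i ∣ (∣∣-≤-sum rest? Q? is proj₂) ⟩
    ∣ Q? i ∣ + sum (map (λ i → ∣ Q? i ∣) is)         ∎
    where
    open ≤-Reasoning
    rest? : Decidable (P ∩ (λ x → Any (λ i → Q i x) is))
    rest? = P? ∩? (λ x → Any.any? (λ i → Q? i x) is)
    split : P ⊆ Q i ∪ (P ∩ (λ x → Any (λ i → Q i x) is))
    split Px with covered Px
    ... | Any.here Qix   = inj₁ Qix
    ... | Any.there Qisx = inj₂ (Px , Qisx)

open module FinCounting {n} = Counting (allFin n) (Unique.allFin⁺ n) ∈-allFin public

∣∣≤n : ∀ {n} {P : Pred (Fin n) 0ℓ} (P? : Decidable P) → ∣ P? ∣ ≤ n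
∣∣≤n {n} P? = ≤-trans (length-filter P? (allFin n)) (≤-reflexive (length-tabulate id))

∣∣≡n : ∀ {n} {P : Pred (Fin n) 0ℓ} (P? : Decidable P) → (∀ x → P x) → ∣ P? ∣ ≡ n
∣∣≡n {n} P? all = trans (cong length (filter-all P? {xs = allFin n} (All.tabulate (λ {x} _ → all x)))) (length-tabulate id)

∣∣-suc-yes : ∀ {n} {P : Pred (Fin (suc n)) 0ℓ} (P? : Decidable P) → P zero → ∣ P? ∣ ≡ suc ∣ P? ∘ suc ∣
∣∣-suc-yes {n} P? P0 rewrite filter-accept P? {xs = List.tabulate {n = n} suc} P0 =
  cong suc (trans (cong (length ∘ filter P?) (sym (map-tabulate id suc))) (length-filter-map P? suc (allFin n)))

∣∣-suc-no : ∀ {n} {P : Pred (Fin (suc n)) 0ℓ} (P? : Decidable P) → ¬ P zero → ∣ P? ∣ ≡ ∣ P? ∘ suc ∣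
∣∣-suc-no {n} P? ¬P0 rewrite filter-reject P? {xs = List.tabulate {n = n} suc} ¬P0 =
  trans (cong (length ∘ filter P?) (sym (map-tabulate id suc))) (length-filter-map P? suc (allFin n))

∈-allSubsets : ∀ {n} (S : Subset n) → S ∈ₗ allSubsets n
∈-allSubsets []                  = Any.here refl
∈-allSubsets {suc n} (true  ∷ S) = ∈-++⁺ˡ (∈-map⁺ (true ∷_) (∈-allSubsets S))
∈-allSubsets {suc n} (false ∷ S) = ∈-++⁺ʳ (map (true ∷_) (allSubsets n)) (∈-map⁺ (false ∷_) (∈-allSubsets S))

allSubsets-unique : ∀ n → Unique (allSubsets n)
allSubsets-unique zero    = [] ∷ []
allSubsets-unique (suc n) =
  Unique.++⁺ (Unique.map⁺ ∷-injectiveʳ (allSubsets-unique n)) (Unique.map⁺ ∷-injectiveʳ (allSubsets-unique n)) heads-differ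
  where
  heads-differ : ∀ {S} → ¬ (S ∈ₗ map (true ∷_) (allSubsets n) × S ∈ₗ map (false ∷_) (allSubsets n))
  heads-differ (S∈t , S∈f) with ∈-map⁻ (true ∷_) S∈t | ∈-map⁻ (false ∷_) S∈f
  ... | _ , _ , refl | _ , _ , ()

-- Defs.count P? is definitionally Subsets.∣ P? ∣.
module Subsets {n} = Counting (allSubsets n) (allSubsets-unique n) ∈-allSubsets

count-suc : ∀ {n} {P : Pred (Subset (suc n)) 0ℓ} (P? : Decidable P) →
            count P? ≡ count (P? ∘ (true ∷_)) + count (P? ∘ (false ∷_))
count-suc {n} P? = begin
  length (filter P? (map (true ∷_) (allSubsets n) ++ map (false ∷_) (allSubsets n)))
    ≡⟨ cong length (filter-++ P? (map (true ∷_) (allSubsets n)) _) ⟩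
  length (filter P? (map (true ∷_) (allSubsets n)) ++ filter P? (map (false ∷_) (allSubsets n)))
    ≡⟨ length-++ (filter P? (map (true ∷_) (allSubsets n))) ⟩
  length (filter P? (map (true ∷_) (allSubsets n))) + length (filter P? (map (false ∷_) (allSubsets n)))
    ≡⟨ cong₂ _+_ (length-filter-map P? (true ∷_) (allSubsets n)) (length-filter-map P? (false ∷_) (allSubsets n)) ⟩
  count (P? ∘ (true ∷_)) + count (P? ∘ (false ∷_)) ∎
  where open ≡-Reasoning

toSubset : ∀ {n} {P : Pred (Fin n) 0ℓ} → Decidable P → Subset n
toSubset {zero}  P? = []
toSubset {suc n} P? = does (P? zero) ∷ toSubset (P? ∘ suc)

∈-toSubset⁺ : ∀ {n} {P : Pred (Fin n) 0ℓ} (P? : Decidable P) {x} → P x → x ∈ toSubset P?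
∈-toSubset⁺ P? {zero} Px with P? zero
... | yes _   = here
... | no ¬Px = contradiction Px ¬Px
∈-toSubset⁺ P? {suc x} Px = there (∈-toSubset⁺ (P? ∘ suc) Px)

∈-toSubset⁻ : ∀ {n} {P : Pred (Fin n) 0ℓ} (P? : Decidable P) {x} → x ∈ toSubset P? → P x
∈-toSubset⁻ P? {zero} x∈ with P? zero
... | yes Px = Px
∈-toSubset⁻ P? {zero} () | no _
∈-toSubset⁻ P? {suc x} (there x∈) = ∈-toSubset⁻ (P? ∘ suc) x∈

SubsetOf : ∀ {n} → Pred (Fin n) 0ℓ → Pred (Subset n) 0ℓ
SubsetOf Z S = ∀ x → x ∈ S → Z x

subsetOf? : ∀ {n} {Z : Pred (Fin n) 0ℓ} → Decidable Z → Decidable (SubsetOf Z)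
subsetOf? Z? S = all? (λ x → x ∈? S →-dec Z? x)

count-subsetOf : ∀ {n} {Z : Pred (Fin n) 0ℓ} (Z? : Decidable Z) → count (subsetOf? Z?) ≡ 2 ^ ∣ Z? ∣
count-subsetOf {zero}  Z? = refl
count-subsetOf {suc n} {Z} Z? = by-head (Z? zero)
  where
  open ≡-Reasoning
  tail⇒ : ∀ {b S} → SubsetOf Z (b ∷ S) → SubsetOf (Z ∘ suc) S
  tail⇒ sub x x∈S = sub (suc x) (there x∈S)
  ⇒false∷ : ∀ {S} → SubsetOf (Z ∘ suc) S → SubsetOf Z (false ∷ S)
  ⇒false∷ sub (suc x) (there x∈S) = sub x x∈S
  ⇒true∷ : Z zero → ∀ {S} → SubsetOf (Z ∘ suc) S → SubsetOf Z (true ∷ S)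
  ⇒true∷ Z0 sub zero    here        = Z0
  ⇒true∷ Z0 sub (suc x) (there x∈S) = sub x x∈S
  k = ∣ Z? ∘ suc ∣
  false-part : count (subsetOf? Z? ∘ (false ∷_)) ≡ 2 ^ k
  false-part = trans (Subsets.≐⇒∣∣≡ _ (subsetOf? (Z? ∘ suc)) (tail⇒ , ⇒false∷)) (count-subsetOf (Z? ∘ suc))
  true-part : Z zero → count (subsetOf? Z? ∘ (true ∷_)) ≡ 2 ^ k
  true-part Z0 = trans (Subsets.≐⇒∣∣≡ _ (subsetOf? (Z? ∘ suc)) (tail⇒ , ⇒true∷ Z0)) (count-subsetOf (Z? ∘ suc))
  by-head : Dec (Z zero) → count (subsetOf? Z?) ≡ 2 ^ ∣ Z? ∣
  by-head (yes Z0) = begin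
    count (subsetOf? Z?)                                                  ≡⟨ count-suc (subsetOf? Z?) ⟩
    count (subsetOf? Z? ∘ (true ∷_)) + count (subsetOf? Z? ∘ (false ∷_))
      ≡⟨ cong₂ _+_ (true-part Z0) false-part ⟩
    2 ^ k + 2 ^ k                                                         ≡⟨ cong (2 ^ k +_) (+-identityʳ _) ⟨
    2 ^ suc k                                                             ≡⟨ cong (2 ^_) (∣∣-suc-yes Z? Z0) ⟨
    2 ^ ∣ Z? ∣                                                            ∎
  by-head (no ¬Z0) = begin
    count (subsetOf? Z?)                                                  ≡⟨ count-suc (subsetOf? Z?) ⟩
    count (subsetOf? Z? ∘ (true ∷_)) + count (subsetOf? Z? ∘ (false ∷_))
      ≡⟨ cong₂ _+_ (Subsets.∣∣≡0 (subsetOf? Z? ∘ (true ∷_)) (λ S sub → ¬Z0 (sub zero here))) false-part ⟩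
    2 ^ k                                                                 ≡⟨ cong (2 ^_) (∣∣-suc-no Z? ¬Z0) ⟨
    2 ^ ∣ Z? ∣                                                            ∎

vectors : ∀ {A : Set} → List A → ∀ k → List (Vec A k)
vectors xs zero    = [] ∷ []
vectors xs (suc k) = List.cartesianProductWith _∷_ xs (vectors xs k)

length-cartesianProductWith : ∀ {A B C : Set} (f : A → B → C) xs ys →
  length (List.cartesianProductWith f xs ys) ≡ length xs * length ys
length-cartesianProductWith f []       ys = refl
length-cartesianProductWith f (x ∷ xs) ys = trans (length-++ (map (f x) ys))
  (cong₂ _+_ (length-map (f x) ys) (length-cartesianProductWith f xs ys))

length-vectors : ∀ {A : Set} (xs : List A) k → length (vectors xs k) ≡ length xs ^ k
length-vectors xs zero    = refl
length-vectors xs (suc k) = trans (length-cartesianProductWith _∷_ xs (vectors xs k)) (cong (length xs *_) (length-vectors xs k))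

∈-vectors : ∀ {A : Set} {xs : List A} → (∀ x → x ∈ₗ xs) → ∀ {k} (v : Vec A k) → v ∈ₗ vectors xs k
∈-vectors ∈-xs []      = Any.here refl
∈-vectors ∈-xs (x ∷ v) = cartesianProductWith⁺ _∷_ (λ { refl refl → refl }) (∈-xs x) (∈-vectors ∈-xs v)

-- Reachability in finite graphs

module _ {n : ℕ} {E : Rel (Fin n) 0ℓ} (E? : Decidable₂ E) (a : Fin n) where

  Ball : ℕ → Pred (Fin n) 0ℓ
  Ball zero    y = a ≡ y
  Ball (suc k) y = Ball k y ⊎ ∃[ x ] Ball k x × E x y

  ball? : ∀ k → Decidable (Ball k)
  ball? zero    y = a Fin.≟ y
  ball? (suc k) y = ball? k y ⊎-dec any? (λ x → ball? k x ×-dec E? x y)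

  centre∈Ball : ∀ k → Ball k a
  centre∈Ball zero    = refl
  centre∈Ball (suc k) = inj₁ (centre∈Ball k)

  Ball⇒Star : ∀ {k y} → Ball k y → Star E a y
  Ball⇒Star {zero}  refl                = Star.ε
  Ball⇒Star {suc k} (inj₁ y∈)           = Ball⇒Star y∈
  Ball⇒Star {suc k} (inj₂ (x , x∈ , e)) = Ball⇒Star x∈ ◅◅ (e ◅ Star.ε)

  Ball-stable : ∀ {k} → Ball (suc k) ⊆ Ball k → Ball (suc (suc k)) ⊆ Ball (suc k)
  Ball-stable stable (inj₁ y∈)           = y∈
  Ball-stable stable (inj₂ (x , x∈ , e)) = inj₂ (x , stable x∈ , e)

  Ball-stable-or-growing : ∀ k → Ball (suc k) ⊆ Ball k ⊎ k < ∣ ball? k ∣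
  Ball-stable-or-growing zero    = inj₂ (∣∣>0 (ball? zero) refl)
  Ball-stable-or-growing (suc k) with any? (λ y → ball? (suc k) y ×-dec ¬? (ball? k y))
  ... | no ¬new = inj₁ (Ball-stable (λ {y} y∈ → decidable-stable (ball? k y) (λ y∉ → ¬new (y , y∈ , y∉))))
  ... | yes (y , y∈ , y∉) with Ball-stable-or-growing k
  ...   | inj₁ stable = contradiction (stable y∈) y∉
  ...   | inj₂ k<∣B∣  = inj₂ (≤-<-trans k<∣B∣ (⊂⇒∣∣< (ball? k) (ball? (suc k)) inj₁ y∈ y∉))

  Ball-closed : Ball (suc n) ⊆ Ball n
  Ball-closed with Ball-stable-or-growing n
  ... | inj₁ stable = stable
  ... | inj₂ n<∣B∣  = contradiction (∣∣≤n (ball? n)) (<⇒≱ n<∣B∣)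

  Star⇒Ball : ∀ {x y} → Ball n x → Star E x y → Ball n y
  Star⇒Ball x∈ Star.ε       = x∈
  Star⇒Ball x∈ (e ◅ path)   = Star⇒Ball (Ball-closed (inj₂ (_ , x∈ , e))) path

  reachable? : Decidable (Star E a)
  reachable? y = map′ Ball⇒Star (Star⇒Ball (centre∈Ball n)) (ball? n y)

m+m+[m+m]≤6*m : ∀ m → (m + m) + (m + m) ≤ 6 * m
m+m+[m+m]≤6*m m = ≤-trans (≤-reflexive (m+m+[m+m]≡4*m m)) (*-monoˡ-≤ m (m≤m+n 4 2))
  where
  m+m+[m+m]≡4*m : ∀ m → (m + m) + (m + m) ≡ 4 * m
  m+m+[m+m]≡4*m = solve-∀

[m*n]^o≡m^o*n^o : ∀ m n o → (m * n) ^ o ≡ m ^ o * n ^ o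
[m*n]^o≡m^o*n^o m n zero    = refl
[m*n]^o≡m^o*n^o m n (suc o) = trans (cong ((m * n) *_) ([m*n]^o≡m^o*n^o m n o)) (*-interchange m n (m ^ o) (n ^ o))

∃⌊log₂⌋ : ∀ n → ∃[ L ] 2 ^ L ≤ suc n × suc n < 2 ^ suc L
∃⌊log₂⌋ zero = 0 , s≤s z≤n , s≤s (s≤s z≤n)
∃⌊log₂⌋ (suc n) with ∃⌊log₂⌋ n
... | L , 2^L≤ , <2^L+1 with suc (suc n) <? 2 ^ suc L
...   | yes <2^L+1′ = L , m≤n⇒m≤1+n 2^L≤ , <2^L+1′
...   | no ≮2^L+1 = suc L , ≤-reflexive 2^L+1≡ , subst (_< 2 ^ suc (suc L)) 2^L+1≡ (^-monoʳ-< 2 (s≤s (s≤s z≤n)) (n<1+n (suc L)))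
  where
  2^L+1≡ : 2 ^ suc L ≡ suc (suc n)
  2^L+1≡ = ≤-antisym (≮⇒≥ ≮2^L+1) <2^L+1

∃⌈/6⌉ : ∀ n → ∃[ κ ] n ≤ 6 * κ × (∀ {m} → n ≤ 6 * m → κ ≤ m)
∃⌈/6⌉ n = (n + 5) / 6 , n≤ , least
  where
  n≤ : n ≤ 6 * ((n + 5) / 6)
  n≤ = +-cancelʳ-≤ 5 n _ (begin
    n + 5                                 ≡⟨ m≡m%n+[m/n]*n (n + 5) 6 ⟩
    (n + 5) % 6 + (n + 5) / 6 * 6         ≤⟨ +-monoˡ-≤ ((n + 5) / 6 * 6) (s≤s⁻¹ (m%n<n (n + 5) 6)) ⟩
    5 + (n + 5) / 6 * 6                   ≡⟨ +-comm 5 _ ⟩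
    (n + 5) / 6 * 6 + 5                   ≡⟨ cong (_+ 5) (*-comm ((n + 5) / 6) 6) ⟩
    6 * ((n + 5) / 6) + 5                 ∎)
    where open ≤-Reasoning
  least : ∀ {m} → n ≤ 6 * m → (n + 5) / 6 ≤ m
  least {m} n≤6m = s≤s⁻¹ (m<n*o⇒m/o<n (begin-strict
    n + 5        ≤⟨ +-monoˡ-≤ 5 n≤6m ⟩
    6 * m + 5    <⟨ ≤-reflexive (6m+5+1≡ m) ⟩
    suc m * 6    ∎))
    where
    open ≤-Reasoning
    6m+5+1≡ : ∀ m → suc (6 * m + 5) ≡ suc m * 6
    6m+5+1≡ = solve-∀

power-bound : ∀ {r L p q} → 1 ≤ L → 1 ≤ q → 2 ^ L ≤ r → r ^ q < 2 ^ p → (r ^ L) ^ (6 * (q * q)) < 2 ^ (6 * (p * p))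
power-bound {r} {L} {p} {q} 1≤L 1≤q 2^L≤r r^q<2^p = begin-strict
  (r ^ L) ^ (6 * (q * q))         ≡⟨ trans (^-*-assoc r L _) (trans (cong (r ^_) (exponents L q)) (sym (^-*-assoc r (q * (L * q)) 6))) ⟩
  (r ^ (q * (L * q))) ^ 6         ≡⟨ cong (_^ 6) (^-*-assoc r q (L * q)) ⟨
  ((r ^ q) ^ (L * q)) ^ 6         <⟨ ^-monoˡ-< 6 (^-monoˡ-< (L * q) {{>-nonZero (*-mono-≤ 1≤L 1≤q)}} r^q<2^p) ⟩
  ((2 ^ p) ^ (L * q)) ^ 6         ≤⟨ ^-monoˡ-≤ 6 (^-monoʳ-≤ (2 ^ p) {{m^n≢0 2 p}} (<⇒≤ Lq<p)) ⟩
  ((2 ^ p) ^ p) ^ 6               ≡⟨ cong (_^ 6) (^-*-assoc 2 p p) ⟩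
  (2 ^ (p * p)) ^ 6               ≡⟨ trans (^-*-assoc 2 (p * p) 6) (cong (2 ^_) (*-comm (p * p) 6)) ⟩
  2 ^ (6 * (p * p))               ∎
  where
  open ≤-Reasoning
  exponents : ∀ L q → L * (6 * (q * q)) ≡ q * (L * q) * 6
  exponents = solve-∀
  Lq<p : L * q < p
  Lq<p = ≰⇒> (λ p≤Lq → <⇒≱ (≤-<-trans 2^Lq≤r^q r^q<2^p) (^-monoʳ-≤ 2 p≤Lq))
    where
    2^Lq≤r^q : 2 ^ (L * q) ≤ r ^ q
    2^Lq≤r^q = subst (_≤ r ^ q) (^-*-assoc 2 L q) (^-monoˡ-≤ q 2^L≤r)

ratio-bound : ∀ {r L A B κ} → 1 ≤ L → 0 < B → 2 ^ L ≤ r → r ≤ 6 * κ →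
              A * 2 ^ κ ≤ (r ^ L + (r ^ L + r)) * B → RatioBound r A B
ratio-bound {r} {L} {A} {B} {κ} 1≤L 0<B 2^L≤r r≤6κ A2^κ≤ p q 1≤q r^q<2^p = begin-strict
  A ^ M * 2 ^ (r * Q)                 ≤⟨ *-monoʳ-≤ (A ^ M) (^-monoʳ-≤ 2 (≤-trans (*-monoˡ-≤ Q r≤6κ) (≤-reflexive (exponents κ Q)))) ⟩
  A ^ M * 2 ^ (κ * M)                 ≡⟨ cong (A ^ M *_) (^-*-assoc 2 κ M) ⟨
  A ^ M * (2 ^ κ) ^ M                 ≡⟨ [m*n]^o≡m^o*n^o A (2 ^ κ) M ⟨
  (A * 2 ^ κ) ^ M                     ≤⟨ ^-monoˡ-≤ M (≤-trans A2^κ≤ (*-monoˡ-≤ B N≤4r^L)) ⟩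
  (4 * r ^ L * B) ^ M                 ≡⟨ trans ([m*n]^o≡m^o*n^o (4 * r ^ L) B M) (cong (_* B ^ M) ([m*n]^o≡m^o*n^o 4 (r ^ L) M)) ⟩
  4 ^ M * (r ^ L) ^ M * B ^ M         <⟨ *-monoˡ-< (B ^ M) {{m^n≢0 B M {{>-nonZero 0<B}}}}
                                           (*-monoʳ-< (4 ^ M) {{m^n≢0 4 M}} (power-bound {p = p} 1≤L 1≤q 2^L≤r r^q<2^p)) ⟩
  4 ^ M * 2 ^ (6 * (p * p)) * B ^ M   ≡⟨ cong (_* B ^ M) (trans (*-comm (4 ^ M) _) (cong (2 ^ (6 * (p * p)) *_) (sym (^-*-assoc 4 6 Q)))) ⟩
  2 ^ (6 * (p * p)) * 4096 ^ Q * B ^ M ∎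
  where
  open ≤-Reasoning
  Q = q * q
  M = 6 * Q
  exponents : ∀ κ Q → 6 * κ * Q ≡ κ * (6 * Q)
  exponents = solve-∀
  r≤r^L : r ≤ r ^ L
  r≤r^L = ≤-trans (≤-reflexive (sym (*-identityʳ r))) (^-monoʳ-≤ r {{>-nonZero (≤-trans (m^n>0 2 L) 2^L≤r)}} 1≤L)
  N≤4r^L : r ^ L + (r ^ L + r) ≤ 4 * r ^ L
  N≤4r^L = +-monoʳ-≤ (r ^ L) (+-monoʳ-≤ (r ^ L) (≤-trans r≤r^L (m≤m+n (r ^ L) (r ^ L + 0))))

-- Cayley graphs of finite abelian groups

abelianGroup : ∀ {r} → FinAbGroup r → AbelianGroup 0ℓ 0ℓ
abelianGroup {r} G = record { FinAbGroup G ; Carrier = Fin r ; _≈_ = _≡_ }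

module _ {r : ℕ} (G : FinAbGroup r) where

  open AbelianGroup (abelianGroup G)
    using (_∙_; ε; _⁻¹; assoc; identityˡ; identityʳ; inverseˡ; inverseʳ; monoid; commutativeSemigroup)
  open import Algebra.Properties.AbelianGroup (abelianGroup G)
    using (inverseˡ-unique; inverseʳ-unique; ε⁻¹≈ε; ⁻¹-involutive; ⁻¹-injective; ⁻¹-anti-homo-//; ⁻¹-∙-comm;
           ∙-cancelˡ; ∙-cancelʳ; x∙y⁻¹≈ε⇒x≈y)
  open import Algebra.Properties.Monoid monoid using (cancelˡ; cancelʳ; cancelᶜ)
  open import Algebra.Properties.CommutativeSemigroup commutativeSemigroup using (interchange)

  ⁻¹-Closed : Pred (Fin r) 0ℓ → Set
  ⁻¹-Closed X = ∀ x → X x → X (x ⁻¹)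

  Step : Pred (Fin r) 0ℓ → Rel (Fin r) 0ℓ
  Step X x y = X (y ∙ x ⁻¹)

  record ⟨_⟩ (X : Pred (Fin r) 0ℓ) (g : Fin r) : Set where
    constructor [_]
    field path : Star (Step X) ε g

  open ⟨_⟩ public

  ⟨_⟩? : ∀ {X} → Decidable X → Decidable ⟨ X ⟩
  ⟨ X? ⟩? g = map′ [_] path (reachable? (λ x y → X? (y ∙ x ⁻¹)) ε g)

  x∙ε⁻¹≡x : ∀ x → x ∙ ε ⁻¹ ≡ x
  x∙ε⁻¹≡x x = trans (cong (x ∙_) ε⁻¹≈ε) (identityʳ x)

  module _ {X : Pred (Fin r) 0ℓ} where

    Step-ε⁺ : ∀ {x} → X x → Step X ε x
    Step-ε⁺ {x} = subst X (sym (x∙ε⁻¹≡x x))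

    Step-ε⁻ : ∀ {x} → Step X ε x → X x
    Step-ε⁻ {x} = subst X (x∙ε⁻¹≡x x)

    step-translate : ∀ c {a b} → Step X a b → Step X (a ∙ c) (b ∙ c)
    step-translate c {a} {b} = subst X (sym (begin
      (b ∙ c) ∙ (a ∙ c) ⁻¹         ≡⟨ cong ((b ∙ c) ∙_) (⁻¹-∙-comm a c) ⟨
      (b ∙ c) ∙ (a ⁻¹ ∙ c ⁻¹)      ≡⟨ interchange b c (a ⁻¹) (c ⁻¹) ⟩
      (b ∙ a ⁻¹) ∙ (c ∙ c ⁻¹)      ≡⟨ cong ((b ∙ a ⁻¹) ∙_) (inverseʳ c) ⟩
      (b ∙ a ⁻¹) ∙ ε               ≡⟨ identityʳ _ ⟩
      b ∙ a ⁻¹                     ∎))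
      where open ≡-Reasoning

    path-translate : ∀ c {a b} → Star (Step X) a b → Star (Step X) (a ∙ c) (b ∙ c)
    path-translate c = Star.gmap (_∙ c) (step-translate c)

    step-reverse : ⁻¹-Closed X → ∀ {a b} → Step X a b → Step X b a
    step-reverse X⁻¹ {a} {b} Xba⁻¹ = subst X (⁻¹-anti-homo-// b a) (X⁻¹ _ Xba⁻¹)

    ε∈⟨⟩ : ⟨ X ⟩ ε
    ε∈⟨⟩ = [ Star.ε ]

    ⊆⟨⟩ : X ⊆ ⟨ X ⟩
    ⊆⟨⟩ Xg = [ Step-ε⁺ Xg ◅ Star.ε ]

    ⟨⟩-∙ : ∀ {a b} → ⟨ X ⟩ a → ⟨ X ⟩ b → ⟨ X ⟩ (b ∙ a)
    ⟨⟩-∙ {a} {b} [ ε→a ] [ ε→b ] = [ ε→a ◅◅ subst (λ x → Star (Step X) x (b ∙ a)) (identityˡ a) (path-translate a ε→b) ]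

    ⟨⟩-⁻¹ : ⁻¹-Closed X → ∀ {a} → ⟨ X ⟩ a → ⟨ X ⟩ (a ⁻¹)
    ⟨⟩-⁻¹ X⁻¹ {a} [ ε→a ] = [ subst₂ (Star (Step X)) (inverseʳ a) (identityˡ (a ⁻¹))
      (path-translate (a ⁻¹) (Star.reverse (step-reverse X⁻¹) ε→a)) ]

    path⇒Step⟨⟩ : ∀ {a b} → Star (Step X) a b → Step ⟨ X ⟩ a b
    path⇒Step⟨⟩ {a} {b} a→b = [ subst (λ x → Star (Step X) x (b ∙ a ⁻¹)) (inverseʳ a) (path-translate (a ⁻¹) a→b) ]

    Step⟨⟩⇒path : ∀ {a b} → Step ⟨ X ⟩ a b → Star (Step X) a b
    Step⟨⟩⇒path {a} {b} [ ε→ba⁻¹ ] = subst₂ (Star (Step X)) (identityˡ a) (cancelʳ (inverseˡ a) b) (path-translate a ε→ba⁻¹)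

  ⟨⟩-least : ∀ {X Y} → X ⊆ ⟨ Y ⟩ → ⟨ X ⟩ ⊆ ⟨ Y ⟩
  ⟨⟩-least {X} {Y} X⊆ [ ε→b ] = go ε∈⟨⟩ ε→b
    where
    go : ∀ {a b} → ⟨ Y ⟩ a → Star (Step X) a b → ⟨ Y ⟩ b
    go a∈ Star.ε                    = a∈
    go {a} a∈ (_◅_ {j = b} e a→b) = go (subst ⟨ Y ⟩ (cancelʳ (inverseˡ a) b) (⟨⟩-∙ a∈ (X⊆ e))) a→b

  ⟨⟩-mono : ∀ {X Y} → X ⊆ Y → ⟨ X ⟩ ⊆ ⟨ Y ⟩
  ⟨⟩-mono X⊆Y = ⟨⟩-least (⊆⟨⟩ ∘ X⊆Y)

  ⟨⟩-universal⇒paths : ∀ {X} → (∀ y → ⟨ X ⟩ y) → ∀ x y → Star (Step X) x y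
  ⟨⟩-universal⇒paths all x y = Step⟨⟩⇒path (all (y ∙ x ⁻¹))

  module _ {X : Pred (Fin r) 0ℓ} (X? : Decidable X) (X⁻¹ : ⁻¹-Closed X) where

    ⟨⟩-⊥-coset : ∀ {g} → ¬ ⟨ X ⟩ g → ⟨ X ⟩ ⊥ Step ⟨ X ⟩ g
    ⟨⟩-⊥-coset {g} g∉ {y} (y∈ , yg⁻¹∈) = g∉ (subst ⟨ X ⟩ (begin
      (y ∙ g ⁻¹) ⁻¹ ∙ y    ≡⟨ cong (_∙ y) (⁻¹-anti-homo-// y g) ⟩
      (g ∙ y ⁻¹) ∙ y       ≡⟨ cancelʳ (inverseˡ y) g ⟩
      g                    ∎) (⟨⟩-∙ y∈ (⟨⟩-⁻¹ X⁻¹ yg⁻¹∈)))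
      where open ≡-Reasoning

    coset-doubling : ∀ {g} → ¬ ⟨ X ⟩ g → ∀ {C} (C? : Decidable C) → ⟨ X ⟩ ⊆ C → Step ⟨ X ⟩ g ⊆ C →
                     ∣ ⟨ X? ⟩? ∣ + ∣ ⟨ X? ⟩? ∣ ≤ ∣ C? ∣
    coset-doubling {g} g∉ C? H⊆C Hg⊆C = begin
      ∣ ⟨ X? ⟩? ∣ + ∣ ⟨ X? ⟩? ∣   ≤⟨ +-monoʳ-≤ ∣ ⟨ X? ⟩? ∣
                                      (∣∣-≤-injection ⟨ X? ⟩? coset? ∈-allFin (_∙ g) translate (λ _ _ → ∙-cancelʳ g _ _)) ⟩
      ∣ ⟨ X? ⟩? ∣ + ∣ coset? ∣     ≤⟨ ∣∣+∣∣-≤-disjoint ⟨ X? ⟩? coset? C? H⊆C Hg⊆C (⟨⟩-⊥-coset g∉) ⟩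
      ∣ C? ∣                       ∎
      where
      open ≤-Reasoning
      coset? : Decidable (Step ⟨ X ⟩ g)
      coset? y = ⟨ X? ⟩? (y ∙ g ⁻¹)
      translate : ∀ {x} → ⟨ X ⟩ x → Step ⟨ X ⟩ g (x ∙ g)
      translate {x} = subst ⟨ X ⟩ (sym (cancelʳ (inverseʳ g) x))

  data Generators {k} (v : Vec (Fin r) k) : Pred (Fin r) 0ℓ where
    gen   : ∀ i → Generators v (lookup v i)
    gen⁻¹ : ∀ i → Generators v (lookup v i ⁻¹)

  generators? : ∀ {k} (v : Vec (Fin r) k) → Decidable (Generators v)
  generators? v g = map′ from to (any? (λ i → g Fin.≟ lookup v i ⊎-dec g Fin.≟ lookup v i ⁻¹))
    where
    from : ∃[ i ] (g ≡ lookup v i ⊎ g ≡ lookup v i ⁻¹) → Generators v g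
    from (i , inj₁ refl) = gen i
    from (i , inj₂ refl) = gen⁻¹ i
    to : Generators v g → ∃[ i ] (g ≡ lookup v i ⊎ g ≡ lookup v i ⁻¹)
    to (gen i)   = i , inj₁ refl
    to (gen⁻¹ i) = i , inj₂ refl

  Generators-⁻¹ : ∀ {k} (v : Vec (Fin r) k) → ⁻¹-Closed (Generators v)
  Generators-⁻¹ v _ (gen i)   = gen⁻¹ i
  Generators-⁻¹ v _ (gen⁻¹ i) = subst (Generators v) (sym (⁻¹-involutive _)) (gen i)

  Generators-∷ : ∀ {k} {g} {v : Vec (Fin r) k} → Generators v ⊆ Generators (g ∷ v)
  Generators-∷ (gen i)   = gen (suc i)
  Generators-∷ (gen⁻¹ i) = gen⁻¹ (suc i)

  module _ {X : Pred (Fin r) 0ℓ} (X? : Decidable X) (X⁻¹ : ⁻¹-Closed X) where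

    Progress : ∀ k → Vec (Fin r) k → Set
    Progress k v = Generators v ⊆ ⟨ X ⟩ × (X ⊆ ⟨ Generators v ⟩ ⊎ 2 ^ k ≤ ∣ ⟨ generators? v ⟩? ∣)

    outside? : ∀ {k} (v : Vec (Fin r) k) → Dec (∃[ g ] X g × ¬ ⟨ Generators v ⟩ g)
    outside? v = any? (λ g → X? g ×-dec ¬? (⟨ generators? v ⟩? g))

    ¬outside⇒covered : ∀ {k} {v : Vec (Fin r) k} → ¬ (∃[ g ] X g × ¬ ⟨ Generators v ⟩ g) → X ⊆ ⟨ Generators v ⟩
    ¬outside⇒covered {v = v} none {g} Xg = decidable-stable (⟨ generators? v ⟩? g) (λ g∉ → none (g , Xg , g∉))

    Progress-grows : ∀ {k g} {v : Vec (Fin r) k} → Progress k v → X g → ¬ ⟨ Generators v ⟩ g →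
                     2 ^ suc k ≤ ∣ ⟨ generators? (g ∷ v) ⟩? ∣
    Progress-grows (_ , inj₁ covered) Xg g∉ = contradiction (covered Xg) g∉
    Progress-grows {k} {g} {v} (_ , inj₂ big) Xg g∉ = begin
      2 ^ k + (2 ^ k + 0)                                   ≡⟨ cong (2 ^ k +_) (+-identityʳ (2 ^ k)) ⟩
      2 ^ k + 2 ^ k                                         ≤⟨ +-mono-≤ big big ⟩
      ∣ ⟨ generators? v ⟩? ∣ + ∣ ⟨ generators? v ⟩? ∣
        ≤⟨ coset-doubling (generators? v) (Generators-⁻¹ v) g∉ ⟨ generators? (g ∷ v) ⟩? (⟨⟩-mono Generators-∷) coset⊆ ⟩
      ∣ ⟨ generators? (g ∷ v) ⟩? ∣                           ∎
      where
      open ≤-Reasoning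
      coset⊆ : Step ⟨ Generators v ⟩ g ⊆ ⟨ Generators (g ∷ v) ⟩
      coset⊆ {y} yg⁻¹∈ = subst ⟨ Generators (g ∷ v) ⟩ (cancelʳ (inverseˡ g) y)
        (⟨⟩-∙ (⊆⟨⟩ (gen zero)) (⟨⟩-mono Generators-∷ yg⁻¹∈))

    Generators-∷⊆ : ∀ {k g} {v : Vec (Fin r) k} → ⟨ X ⟩ g → Generators v ⊆ ⟨ X ⟩ → Generators (g ∷ v) ⊆ ⟨ X ⟩
    Generators-∷⊆ g∈ gens (gen zero)      = g∈
    Generators-∷⊆ g∈ gens (gen⁻¹ zero)    = ⟨⟩-⁻¹ X⁻¹ g∈
    Generators-∷⊆ g∈ gens (gen (suc i))   = gens (gen i)
    Generators-∷⊆ g∈ gens (gen⁻¹ (suc i)) = gens (gen⁻¹ i)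

    greedy : ∀ k → Σ (Vec (Fin r) k) (Progress k)
    greedy zero = [] , (λ { (gen ()) ; (gen⁻¹ ()) }) , inj₂ (∣∣>0 ⟨ generators? [] ⟩? ε∈⟨⟩)
    greedy (suc k) with greedy k
    ... | v , gens , progress with outside? v
    ...   | yes (g , Xg , g∉) = g ∷ v , Generators-∷⊆ (⊆⟨⟩ Xg) gens , inj₂ (Progress-grows (gens , progress) Xg g∉)
    ...   | no none           = ε ∷ v , Generators-∷⊆ ε∈⟨⟩ gens , inj₁ (⟨⟩-mono Generators-∷ ∘ ¬outside⇒covered none)

    generating-vector : ∀ {L} → r < 2 ^ suc L → Σ[ v ∈ Vec (Fin r) L ] ⟨ Generators v ⟩ ≐ ⟨ X ⟩
    generating-vector {L} r<2^L+1 with greedy L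
    ... | v , gens , progress with outside? v
    ...   | yes (g , Xg , g∉) = contradiction (≤-trans (Progress-grows (gens , progress) Xg g∉) (∣∣≤n _)) (<⇒≱ r<2^L+1)
    ...   | no none           = v , ⟨⟩-least gens , ⟨⟩-least (¬outside⇒covered none)

  -- Representatives of inverse pairs and inverse-closed sets

  R : Pred (Fin r) 0ℓ
  R x = x Fin.≤ x ⁻¹

  R? : Decidable R
  R? x = x Fin.≤? x ⁻¹

  rep : Fin r → Fin r
  rep x with R? x
  ... | yes _ = x
  ... | no _  = x ⁻¹

  rep-R : ∀ {x} → R x → rep x ≡ x
  rep-R {x} Rx with R? x
  ... | yes _  = refl
  ... | no ¬Rx = contradiction Rx ¬Rx

  rep-¬R : ∀ {x} → ¬ R x → rep x ≡ x ⁻¹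
  rep-¬R {x} ¬Rx with R? x
  ... | yes Rx = contradiction Rx ¬Rx
  ... | no _   = refl

  ¬R⇒R⁻¹ : ∀ {x} → ¬ R x → R (x ⁻¹)
  ¬R⇒R⁻¹ {x} ¬Rx = subst (x ⁻¹ Fin.≤_) (sym (⁻¹-involutive x)) (<⇒≤ (≰⇒> ¬Rx))

  R-rep : ∀ x → R (rep x)
  R-rep x with R? x
  ... | yes Rx = Rx
  ... | no ¬Rx = ¬R⇒R⁻¹ ¬Rx

  R∧R⁻¹⇒self-inverse : ∀ {x} → R x → R (x ⁻¹) → x ⁻¹ ≡ x
  R∧R⁻¹⇒self-inverse {x} Rx Rx⁻¹ = Fin.≤-antisym (subst (x ⁻¹ Fin.≤_) (⁻¹-involutive x) Rx⁻¹) Rx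

  self-inverse⇒R : ∀ {x} → x ⁻¹ ≡ x → R x
  self-inverse⇒R x⁻¹≡x = Fin.≤-reflexive (sym x⁻¹≡x)

  rep-⁻¹ : ∀ x → rep (x ⁻¹) ≡ rep x
  rep-⁻¹ x = by-cases (R? x) (R? (x ⁻¹))
    where
    by-cases : Dec (R x) → Dec (R (x ⁻¹)) → rep (x ⁻¹) ≡ rep x
    by-cases (yes Rx) (yes Rx⁻¹) = trans (rep-R Rx⁻¹) (trans (R∧R⁻¹⇒self-inverse Rx Rx⁻¹) (sym (rep-R Rx)))
    by-cases (yes Rx) (no ¬Rx⁻¹) = trans (rep-¬R ¬Rx⁻¹) (trans (⁻¹-involutive x) (sym (rep-R Rx)))
    by-cases (no ¬Rx) (yes Rx⁻¹) = trans (rep-R Rx⁻¹) (sym (rep-¬R ¬Rx))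
    by-cases (no ¬Rx) (no ¬Rx⁻¹) = contradiction (¬R⇒R⁻¹ ¬Rx) ¬Rx⁻¹

  rep-cases : ∀ x → rep x ≡ x ⊎ rep x ≡ x ⁻¹
  rep-cases x with R? x
  ... | yes _ = inj₁ refl
  ... | no _  = inj₂ refl

  ⁻¹-Closed-rep : ∀ {Y} → ⁻¹-Closed Y → ∀ {x} → Y x → Y (rep x)
  ⁻¹-Closed-rep {Y} Y⁻¹ {x} Yx with rep-cases x
  ... | inj₁ rep≡x   = subst Y (sym rep≡x) Yx
  ... | inj₂ rep≡x⁻¹ = subst Y (sym rep≡x⁻¹) (Y⁻¹ x Yx)

  ∣∣≤2∣R∩∣ : ∀ {Y} (Y? : Decidable Y) → ⁻¹-Closed Y → ∣ Y? ∣ ≤ ∣ R? ∩? Y? ∣ + ∣ R? ∩? Y? ∣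
  ∣∣≤2∣R∩∣ Y? Y⁻¹ = ∣∣-≤-two-to-one Y? (R? ∩? Y?) R? rep (λ {x} Yx → R-rep x , ⁻¹-Closed-rep Y⁻¹ Yx)
    (λ (_ , Rx) (_ , Ry) rep≡ → trans (sym (rep-R Rx)) (trans rep≡ (rep-R Ry)))
    (λ (_ , ¬Rx) (_ , ¬Ry) rep≡ → ⁻¹-injective (trans (sym (rep-¬R ¬Rx)) (trans rep≡ (rep-¬R ¬Ry))))

  inverseClosed? : Decidable (InverseClosed G)
  inverseClosed? S = all? (λ x → x ∈? S →-dec x ⁻¹ ∈? S)

  rep∈⇒∈ : ∀ {S x} → InverseClosed G S → rep x ∈ S → x ∈ S
  rep∈⇒∈ {S} {x} S⁻¹ rep∈ with rep-cases x
  ... | inj₁ rep≡x   = subst (_∈ S) rep≡x rep∈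
  ... | inj₂ rep≡x⁻¹ = subst (_∈ S) (⁻¹-involutive x) (S⁻¹ _ (subst (_∈ S) rep≡x⁻¹ rep∈))

  inverseClosed-⊆ : ∀ {S T} → InverseClosed G S → InverseClosed G T →
                    (∀ {x} → R x → x ∈ S → x ∈ T) → (_∈ S) ⊆ (_∈ T)
  inverseClosed-⊆ S⁻¹ T⁻¹ S⊆T-on-R {x} x∈S = rep∈⇒∈ T⁻¹ (S⊆T-on-R (R-rep x) (⁻¹-Closed-rep S⁻¹ x∈S))

  ∈∪⁻¹∈? : ∀ T → Decidable (λ x → x ∈ T ⊎ x ⁻¹ ∈ T)
  ∈∪⁻¹∈? T x = x ∈? T ⊎-dec x ⁻¹ ∈? T

  symmetrise : Subset r → Subset r
  symmetrise T = toSubset (∈∪⁻¹∈? T)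

  symmetrise-inverseClosed : ∀ T → InverseClosed G (symmetrise T)
  symmetrise-inverseClosed T x x∈ with ∈-toSubset⁻ (∈∪⁻¹∈? T) x∈
  ... | inj₁ x∈T   = ∈-toSubset⁺ (∈∪⁻¹∈? T) (inj₂ (subst (_∈ T) (sym (⁻¹-involutive x)) x∈T))
  ... | inj₂ x⁻¹∈T = ∈-toSubset⁺ (∈∪⁻¹∈? T) (inj₁ x⁻¹∈T)

  symmetrise-injective : ∀ {T T′} → SubsetOf R T → SubsetOf R T′ → symmetrise T ≡ symmetrise T′ → T ≡ T′
  symmetrise-injective T⊆R T′⊆R eq = Subsetₚ.⊆-antisym (half T⊆R T′⊆R eq) (half T′⊆R T⊆R (sym eq))
    where
    half : ∀ {T T′} → SubsetOf R T → SubsetOf R T′ → symmetrise T ≡ symmetrise T′ → (_∈ T) ⊆ (_∈ T′)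
    half {T} {T′} T⊆R T′⊆R eq {x} x∈T
      with ∈-toSubset⁻ (∈∪⁻¹∈? T′)
             (subst (x ∈_) eq (∈-toSubset⁺ (∈∪⁻¹∈? T) (inj₁ x∈T)))
    ... | inj₁ x∈T′   = x∈T′
    ... | inj₂ x⁻¹∈T′ = subst (_∈ T′) (R∧R⁻¹⇒self-inverse (T⊆R x x∈T) (T′⊆R _ x⁻¹∈T′)) x⁻¹∈T′

  2^∣R∣≤count-inverseClosed : (ic? : Decidable (InverseClosed G)) → 2 ^ ∣ R? ∣ ≤ count ic?
  2^∣R∣≤count-inverseClosed ic? = subst (_≤ count ic?) (count-subsetOf R?)
    (Subsets.∣∣-≤-injection (subsetOf? R?) ic? ∈-allSubsets symmetrise
      (λ {T} _ → symmetrise-inverseClosed T) symmetrise-injective)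

  -- Small families of inverse-closed sets

  record SmallFamily : Set₁ where
    field
      Member     : Pred (Subset r) 0ℓ
      member?    : Decidable Member
      Free       : Pred (Fin r) 0ℓ
      free?      : Decidable Free
      Free⊆R     : Free ⊆ R
      determined : ∀ {S T} → Member S → Member T → (∀ {x} → (R ∖ Free) x → x ∈ S → x ∈ T) → (_∈ S) ⊆ (_∈ T)
      large      : ∀ {S} → Member S → r ≤ 6 * ∣ free? ∣

    support? : Decidable (R ∖ Free)
    support? = R? ∩? ∁? free?

    restrict : Subset r → Subset r
    restrict S = toSubset (support? ∩? (_∈? S))

    restrict-⊆ : ∀ {S T} → restrict S ≡ restrict T → ∀ {x} → (R ∖ Free) x → x ∈ S → x ∈ T
    restrict-⊆ {S} {T} eq supp x∈S = proj₂ (∈-toSubset⁻ (support? ∩? (_∈? T))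
      (subst (_ ∈_) eq (∈-toSubset⁺ (support? ∩? (_∈? S)) (supp , x∈S))))

    count≤2^∣support∣ : count member? ≤ 2 ^ ∣ support? ∣
    count≤2^∣support∣ = subst (count member? ≤_) (count-subsetOf support?)
      (Subsets.∣∣-≤-injection member? (subsetOf? support?) ∈-allSubsets restrict
        (λ {S} _ x x∈ → proj₁ (∈-toSubset⁻ (support? ∩? (_∈? S)) x∈))
        (λ mS mT eq → Subsetₚ.⊆-antisym (determined mS mT (restrict-⊆ eq)) (determined mT mS (restrict-⊆ (sym eq)))))

    count-bound : ∀ {κ} → (∀ {m} → r ≤ 6 * m → κ ≤ m) → count member? * 2 ^ κ ≤ 2 ^ ∣ R? ∣
    count-bound {κ} κ-least with Subsetₚ.anySubset? member?
    ... | no ¬member = ≤-trans (≤-reflexive (cong (_* 2 ^ κ) (Subsets.∣∣≡0 member? (λ S mS → ¬member (S , mS))))) z≤n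
    ... | yes (S , mS) = begin
      count member? * 2 ^ κ                       ≤⟨ *-mono-≤ count≤2^∣support∣ (^-monoʳ-≤ 2 (κ-least {∣ free? ∣} (large mS))) ⟩
      2 ^ ∣ support? ∣ * 2 ^ ∣ free? ∣            ≡⟨ ^-distribˡ-+-* 2 ∣ support? ∣ ∣ free? ∣ ⟨
      2 ^ (∣ support? ∣ + ∣ free? ∣)              ≤⟨ ^-monoʳ-≤ 2 (∣∣+∣∣-≤-disjoint support? free? R? proj₁ Free⊆R (λ ((_ , ¬Fx) , Fx) → ¬Fx Fx)) ⟩
      2 ^ ∣ R? ∣                                  ∎
      where open ≤-Reasoning

  U? : Decidable {A = Fin r} U
  U? _ = yes tt

  ∣U∣≡r : ∣ U? ∣ ≡ r
  ∣U∣≡r = ∣∣≡n U? (λ _ → tt)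

  module _ {L} (v : Vec (Fin r) L) where

    private
      H = ⟨ Generators v ⟩
      H? = ⟨ generators? v ⟩?

    ∁⟨⟩-⁻¹ : ⁻¹-Closed (∁ H)
    ∁⟨⟩-⁻¹ x ¬Hx Hx⁻¹ = ¬Hx (subst H (⁻¹-involutive x) (⟨⟩-⁻¹ (Generators-⁻¹ v) Hx⁻¹))

    disconnected : SmallFamily
    disconnected = record
      { Member     = λ S → InverseClosed G S × SubsetOf H S × ¬ (∀ y → H y)
      ; member?    = λ S → inverseClosed? S ×-dec subsetOf? H? S ×-dec ¬? (all? H?)
      ; Free       = R ∖ H
      ; free?      = R? ∩? ∁? H?
      ; Free⊆R     = proj₁
      ; determined = λ (S⁻¹ , S⊆H , _) (T⁻¹ , _ , _) agree → inverseClosed-⊆ S⁻¹ T⁻¹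
                       (λ Rx x∈S → agree (Rx , λ (_ , ¬Hx) → ¬Hx (S⊆H _ x∈S)) x∈S)
      ; large      = λ (_ , _ , ¬all) → large (proj₂ (¬∀⟶∃¬ r H H? ¬all))
      }
      where
      large : ∀ {g} → ¬ H g → r ≤ 6 * ∣ R? ∩? ∁? H? ∣
      large g∉ = begin
        r                                 ≤⟨ r≤a+b ⟩
        ∣ H? ∣ + ∣ ∁? H? ∣                ≤⟨ +-monoˡ-≤ ∣ ∁? H? ∣ (+-cancelˡ-≤ ∣ H? ∣ _ _ (≤-trans 2a≤r r≤a+b)) ⟩
        ∣ ∁? H? ∣ + ∣ ∁? H? ∣             ≤⟨ +-mono-≤ ∁H≤ ∁H≤ ⟩
        (c + c) + (c + c)                 ≤⟨ m+m+[m+m]≤6*m c ⟩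
        6 * c                             ∎
        where
        open ≤-Reasoning
        c = ∣ R? ∩? ∁? H? ∣
        2a≤r : ∣ H? ∣ + ∣ H? ∣ ≤ r
        2a≤r = subst (∣ H? ∣ + ∣ H? ∣ ≤_) ∣U∣≡r (coset-doubling (generators? v) (Generators-⁻¹ v) g∉ U? _ _)
        r≤a+b : r ≤ ∣ H? ∣ + ∣ ∁? H? ∣
        r≤a+b = subst (_≤ ∣ H? ∣ + ∣ ∁? H? ∣) ∣U∣≡r (∣∣-≤-∪ U? H? (∁? H?) (λ {x} _ → toSum (H? x)))
        ∁H≤ : ∣ ∁? H? ∣ ≤ c + c
        ∁H≤ = ∣∣≤2∣R∩∣ (∁? H?) ∁⟨⟩-⁻¹

    bipartite : SmallFamily
    bipartite = record
      { Member     = λ S → InverseClosed G S × (∀ x → x ∈ S → ¬ H x) × r ≤ ∣ H? ∣ + ∣ H? ∣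
      ; member?    = λ S → inverseClosed? S ×-dec all? (λ x → x ∈? S →-dec ¬? (H? x)) ×-dec r ≤? ∣ H? ∣ + ∣ H? ∣
      ; Free       = R ∩ H
      ; free?      = R? ∩? H?
      ; Free⊆R     = proj₁
      ; determined = λ (S⁻¹ , S∩H≡∅ , _) (T⁻¹ , _ , _) agree → inverseClosed-⊆ S⁻¹ T⁻¹
                       (λ Rx x∈S → agree (Rx , λ (_ , Hx) → S∩H≡∅ _ x∈S Hx) x∈S)
      ; large      = λ (_ , _ , r≤2∣H∣) → begin
          r                                                           ≤⟨ r≤2∣H∣ ⟩
          ∣ H? ∣ + ∣ H? ∣                                             ≤⟨ +-mono-≤ H≤ H≤ ⟩
          (∣ R? ∩? H? ∣ + ∣ R? ∩? H? ∣) + (∣ R? ∩? H? ∣ + ∣ R? ∩? H? ∣) ≤⟨ m+m+[m+m]≤6*m ∣ R? ∩? H? ∣ ⟩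
          6 * ∣ R? ∩? H? ∣                                            ∎
      }
      where
      open ≤-Reasoning
      H≤ : ∣ H? ∣ ≤ ∣ R? ∩? H? ∣ + ∣ R? ∩? H? ∣
      H≤ = ∣∣≤2∣R∩∣ H? (λ _ → ⟨⟩-⁻¹ (Generators-⁻¹ v))

  -- Periodic sets

  rep-∙-invertible : ∀ {x c} → R x → x ≡ rep (rep (x ∙ c) ∙ c) ⊎ x ≡ rep (rep (x ∙ c) ∙ c ⁻¹)
  rep-∙-invertible {x} {c} Rx with rep-cases (x ∙ c)
  ... | inj₁ rep≡ = inj₂ (sym (begin
    rep (rep (x ∙ c) ∙ c ⁻¹)   ≡⟨ cong (λ z → rep (z ∙ c ⁻¹)) rep≡ ⟩
    rep ((x ∙ c) ∙ c ⁻¹)       ≡⟨ cong rep (cancelʳ (inverseʳ c) x) ⟩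
    rep x                      ≡⟨ rep-R Rx ⟩
    x                          ∎))
    where open ≡-Reasoning
  ... | inj₂ rep≡ = inj₁ (sym (begin
    rep (rep (x ∙ c) ∙ c)      ≡⟨ cong (λ z → rep (z ∙ c)) rep≡ ⟩
    rep ((x ∙ c) ⁻¹ ∙ c)       ≡⟨ cong (λ z → rep (z ∙ c)) (⁻¹-∙-comm x c) ⟨
    rep ((x ⁻¹ ∙ c ⁻¹) ∙ c)    ≡⟨ cong rep (cancelʳ (inverseˡ c) (x ⁻¹)) ⟩
    rep (x ⁻¹)                 ≡⟨ rep-⁻¹ x ⟩
    rep x                      ≡⟨ rep-R Rx ⟩
    x                          ∎))
    where open ≡-Reasoning

  rep-∙≡⇒square : ∀ {x c} → c ≢ ε → rep (x ∙ c) ≡ x → x ∙ x ≡ c ⁻¹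
  rep-∙≡⇒square {x} {c} c≢ε rep≡x with rep-cases (x ∙ c)
  ... | inj₁ rep≡ = contradiction (∙-cancelˡ x c ε (trans (trans (sym rep≡) rep≡x) (sym (identityʳ x)))) c≢ε
  ... | inj₂ rep≡ = inverseˡ-unique (x ∙ x) c (begin
    (x ∙ x) ∙ c                ≡⟨ assoc x x c ⟩
    x ∙ (x ∙ c)                ≡⟨ cong (_∙ (x ∙ c)) (trans (sym rep≡x) rep≡) ⟩
    (x ∙ c) ⁻¹ ∙ (x ∙ c)       ≡⟨ inverseˡ (x ∙ c) ⟩
    ε                          ∎)
    where open ≡-Reasoning

  module _ (h : Fin r) where

    -- Membership in an h-periodic inverse-closed set is constant along y ∼ up y and y ∼ down y,
    -- so such a set is determined by its trace on the points of R with no smaller neighbour.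
    up down : Fin r → Fin r
    up   y = rep (y ∙ h)
    down y = rep (y ∙ h ⁻¹)

    NonMinimal : Pred (Fin r) 0ℓ
    NonMinimal y = R y × (up y Fin.< y ⊎ down y Fin.< y)

    nonMinimal? : Decidable NonMinimal
    nonMinimal? y = R? y ×-dec (up y Fin.<? y ⊎-dec down y Fin.<? y)

    Periodic : Pred (Subset r) 0ℓ
    Periodic S = ∀ x → (x ∈ S → x ∙ h ∈ S) × (x ∙ h ∈ S → x ∈ S)

    periodic? : Decidable Periodic
    periodic? S = all? (λ x → (x ∈? S →-dec x ∙ h ∈? S) ×-dec (x ∙ h ∈? S →-dec x ∈? S))

    module _ {S} (S⁻¹ : InverseClosed G S) (S-periodic : Periodic S) where

      ∈⇒up∈ : ∀ {y} → y ∈ S → up y ∈ S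
      ∈⇒up∈ {y} y∈ = ⁻¹-Closed-rep S⁻¹ {y ∙ h} (proj₁ (S-periodic y) y∈)

      up∈⇒∈ : ∀ {y} → up y ∈ S → y ∈ S
      up∈⇒∈ {y} up∈ = proj₂ (S-periodic y) (rep∈⇒∈ {x = y ∙ h} S⁻¹ up∈)

      ∈⇒down∈ : ∀ {y} → y ∈ S → down y ∈ S
      ∈⇒down∈ {y} y∈ = ⁻¹-Closed-rep S⁻¹ {y ∙ h ⁻¹}
        (proj₂ (S-periodic (y ∙ h ⁻¹)) (subst (_∈ S) (sym (cancelʳ (inverseˡ h) y)) y∈))

      down∈⇒∈ : ∀ {y} → down y ∈ S → y ∈ S
      down∈⇒∈ {y} down∈ = subst (_∈ S) (cancelʳ (inverseˡ h) y)
        (proj₁ (S-periodic (y ∙ h ⁻¹)) (rep∈⇒∈ {x = y ∙ h ⁻¹} S⁻¹ down∈))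

    periodic-determined : ∀ {S T} → InverseClosed G S → Periodic S → InverseClosed G T → Periodic T →
                          (∀ {x} → (R ∖ NonMinimal) x → x ∈ S → x ∈ T) → (_∈ S) ⊆ (_∈ T)
    periodic-determined {S} {T} S⁻¹ S-per T⁻¹ T-per agree = inverseClosed-⊆ S⁻¹ T⁻¹ (go (Fin.<-wellFounded _))
      where
      go : ∀ {y} → Acc Fin._<_ y → R y → y ∈ S → y ∈ T
      go {y} (acc smaller) Ry y∈S with nonMinimal? y
      ... | no minimal           = agree (Ry , minimal) y∈S
      ... | yes (_ , inj₁ up<y)   = up∈⇒∈ T⁻¹ T-per (go (smaller up<y) (R-rep (y ∙ h)) (∈⇒up∈ S⁻¹ S-per y∈S))
      ... | yes (_ , inj₂ down<y) = down∈⇒∈ T⁻¹ T-per (go (smaller down<y) (R-rep (y ∙ h ⁻¹)) (∈⇒down∈ S⁻¹ S-per y∈S))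

    _∼_ : Rel (Fin r) 0ℓ
    x ∼ y = x ≡ up y ⊎ x ≡ down y

    ∼-sym : ∀ {x y} → R y → x ∼ y → y ∼ x
    ∼-sym Ry (inj₁ refl) = rep-∙-invertible Ry
    ∼-sym {y = y} Ry (inj₂ refl) with rep-∙-invertible {c = h ⁻¹} Ry
    ... | inj₁ y≡ = inj₂ y≡
    ... | inj₂ y≡ = inj₁ (trans y≡ (cong (λ c → rep (down y ∙ c)) (⁻¹-involutive h)))

    module _ (h≢ε : h ≢ ε) where

      h⁻¹≢ε : h ⁻¹ ≢ ε
      h⁻¹≢ε h⁻¹≡ε = h≢ε (trans (sym (⁻¹-involutive h)) (trans (cong _⁻¹ h⁻¹≡ε) ε⁻¹≈ε))

      Fixed : Pred (Fin r) 0ℓ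
      Fixed y = R y × up y ≡ y × down y ≡ y

      fixed? : Decidable Fixed
      fixed? y = R? y ×-dec up y Fin.≟ y ×-dec down y Fin.≟ y

      Fixed⇒square≡h : ∀ {y} → Fixed y → y ∙ y ≡ h
      Fixed⇒square≡h (_ , _ , down≡) = trans (rep-∙≡⇒square h⁻¹≢ε down≡) (⁻¹-involutive h)

      Fixed⇒square≡h⁻¹ : ∀ {y} → Fixed y → y ∙ y ≡ h ⁻¹
      Fixed⇒square≡h⁻¹ (_ , up≡ , _) = rep-∙≡⇒square h≢ε up≡

      LocalMin : Pred (Fin r) 0ℓ
      LocalMin = (R ∖ NonMinimal) ∖ Fixed

      localMin? : Decidable LocalMin
      localMin? = (R? ∩? ∁? nonMinimal?) ∩? ∁? fixed?

      other : Fin r → Fin r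
      other y with up y Fin.≟ y
      ... | yes _ = down y
      ... | no _  = up y

      other∼ : ∀ y → other y ∼ y
      other∼ y with up y Fin.≟ y
      ... | yes _ = inj₂ refl
      ... | no _  = inj₁ refl

      other≢ : ∀ {y} → R y → ¬ Fixed y → other y ≢ y
      other≢ {y} Ry ¬fixed with up y Fin.≟ y
      ... | yes up≡ = λ down≡ → ¬fixed (Ry , up≡ , down≡)
      ... | no up≢  = up≢

      other-NonMinimal : ∀ {y} → LocalMin y → NonMinimal (other y)
      other-NonMinimal {y} ((Ry , minimal) , ¬fixed) = R-other , has-smaller (∼-sym Ry (other∼ y))
        where
        R-other : R (other y)
        R-other = [ (λ eq → subst R (sym eq) (R-rep (y ∙ h))) , (λ eq → subst R (sym eq) (R-rep (y ∙ h ⁻¹))) ]′ (other∼ y)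
        y≤other : y Fin.≤ other y
        y≤other = [ (λ eq → subst (y Fin.≤_) (sym eq) (≮⇒≥ (λ up<y → minimal (Ry , inj₁ up<y))))
                  , (λ eq → subst (y Fin.≤_) (sym eq) (≮⇒≥ (λ down<y → minimal (Ry , inj₂ down<y)))) ]′ (other∼ y)
        y<other : y Fin.< other y
        y<other = Fin.≤∧≢⇒< y≤other (≢-sym (other≢ Ry ¬fixed))
        has-smaller : y ∼ other y → up (other y) Fin.< other y ⊎ down (other y) Fin.< other y
        has-smaller (inj₁ y≡) = inj₁ (subst (Fin._< other y) y≡ y<other)
        has-smaller (inj₂ y≡) = inj₂ (subst (Fin._< other y) y≡ y<other)

      -- A local minimum y that is not Fixed is up or down of its neighbour other y, which is non-minimal.
      ∣LocalMin∣≤2∣NonMinimal∣ : ∣ localMin? ∣ ≤ ∣ nonMinimal? ∣ + ∣ nonMinimal? ∣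
      ∣LocalMin∣≤2∣NonMinimal∣ = ∣∣-≤-two-to-one localMin? nonMinimal? (λ y → y Fin.≟ up (other y)) other other-NonMinimal
        (λ (_ , x≡) (_ , y≡) other≡ → trans x≡ (trans (cong up other≡) (sym y≡)))
        (λ (lx , x≢) (ly , y≢) other≡ → trans (≡down lx x≢) (trans (cong down other≡) (sym (≡down ly y≢))))
        where
        ≡down : ∀ {y} → LocalMin y → y ≢ up (other y) → y ≡ down (other y)
        ≡down {y} ((Ry , _) , _) y≢ = [ (λ y≡ → contradiction y≡ y≢) , id ]′ (∼-sym Ry (other∼ y))

      Fixed-rep⇒square≡h : ∀ {x} → Fixed (rep x) → x ∙ x ≡ h
      Fixed-rep⇒square≡h {x} fixed with rep-cases x
      ... | inj₁ rep≡x   = subst (λ z → z ∙ z ≡ h) rep≡x (Fixed⇒square≡h fixed)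
      ... | inj₂ rep≡x⁻¹ = ⁻¹-injective (begin
        (x ∙ x) ⁻¹         ≡⟨ ⁻¹-∙-comm x x ⟨
        x ⁻¹ ∙ x ⁻¹        ≡⟨ subst (λ z → z ∙ z ≡ h ⁻¹) rep≡x⁻¹ (Fixed⇒square≡h⁻¹ fixed) ⟩
        h ⁻¹               ∎)
        where open ≡-Reasoning

      -- A Fixed point y₀ forces h = h⁻¹; every x with Fixed (rep x) then has x ∙ x ≡ h, so x ∙ y₀ ⁻¹
      -- is an involution outside Fixed, and φ maps G at most two-to-one into R ∖ Fixed.
      module _ {y₀} (y₀-fixed : Fixed y₀) where

        φ : Fin r → Fin r
        φ x with fixed? (rep x)
        ... | yes _ = x ∙ y₀ ⁻¹
        ... | no _  = rep x

        φ-fixed : ∀ {x} → Fixed (rep x) → φ x ≡ x ∙ y₀ ⁻¹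
        φ-fixed {x} fixed with fixed? (rep x)
        ... | yes _     = refl
        ... | no ¬fixed = contradiction fixed ¬fixed

        φ-unfixed : ∀ {x} → ¬ Fixed (rep x) → φ x ≡ rep x
        φ-unfixed {x} ¬fixed with fixed? (rep x)
        ... | yes fixed = contradiction fixed ¬fixed
        ... | no _      = refl

        shift-square≡ε : ∀ {x} → Fixed (rep x) → (x ∙ y₀ ⁻¹) ∙ (x ∙ y₀ ⁻¹) ≡ ε
        shift-square≡ε {x} fixed = begin
          (x ∙ y₀ ⁻¹) ∙ (x ∙ y₀ ⁻¹)    ≡⟨ interchange x (y₀ ⁻¹) x (y₀ ⁻¹) ⟩
          (x ∙ x) ∙ (y₀ ⁻¹ ∙ y₀ ⁻¹)    ≡⟨ cong₂ _∙_ (Fixed-rep⇒square≡h fixed) (⁻¹-∙-comm y₀ y₀) ⟩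
          h ∙ (y₀ ∙ y₀) ⁻¹             ≡⟨ cong (λ z → h ∙ z ⁻¹) (Fixed⇒square≡h y₀-fixed) ⟩
          h ∙ h ⁻¹                     ≡⟨ inverseʳ h ⟩
          ε                            ∎
          where open ≡-Reasoning

        shift-self-inverse : ∀ {x} → Fixed (rep x) → (x ∙ y₀ ⁻¹) ⁻¹ ≡ x ∙ y₀ ⁻¹
        shift-self-inverse {x} fixed = sym (inverseʳ-unique _ _ (shift-square≡ε {x} fixed))

        φ-R∖Fixed : ∀ x → (R ∖ Fixed) (φ x)
        φ-R∖Fixed x with fixed? (rep x)
        ... | yes fixed = self-inverse⇒R (shift-self-inverse {x} fixed) ,
                          λ u-fixed → h≢ε (trans (sym (Fixed⇒square≡h u-fixed)) (shift-square≡ε {x} fixed))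
        ... | no ¬fixed = R-rep x , ¬fixed

        Regular : Pred (Fin r) 0ℓ
        Regular x = ¬ Fixed (rep x) × R x

        regular? : Decidable Regular
        regular? x = ¬? (fixed? (rep x)) ×-dec R? x

        irregular-cases : ∀ {x} → ¬ Regular x → Fixed (rep x) ⊎ (¬ Fixed (rep x) × ¬ R x)
        irregular-cases {x} ¬regular with fixed? (rep x)
        ... | yes fixed = inj₁ fixed
        ... | no ¬fixed = inj₂ (¬fixed , λ Rx → ¬regular (¬fixed , Rx))

        shift≡⁻¹⇒R : ∀ {x y} → Fixed (rep x) → x ∙ y₀ ⁻¹ ≡ y ⁻¹ → R y
        shift≡⁻¹⇒R {x} {y} fixed eq = self-inverse⇒R (sym (begin
          y                  ≡⟨ ⁻¹-involutive y ⟨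
          (y ⁻¹) ⁻¹          ≡⟨ cong _⁻¹ eq ⟨
          (x ∙ y₀ ⁻¹) ⁻¹     ≡⟨ shift-self-inverse {x} fixed ⟩
          x ∙ y₀ ⁻¹          ≡⟨ eq ⟩
          y ⁻¹               ∎))
          where open ≡-Reasoning

        φ-injective-irregular : ∀ {x y} → ¬ Regular x → ¬ Regular y → φ x ≡ φ y → x ≡ y
        φ-injective-irregular {x} {y} ¬rx ¬ry φ≡ with irregular-cases {x} ¬rx | irregular-cases {y} ¬ry
        ... | inj₁ fx | inj₁ fy =
          ∙-cancelʳ (y₀ ⁻¹) x y (trans (sym (φ-fixed {x} fx)) (trans φ≡ (φ-fixed {y} fy)))
        ... | inj₂ (¬fx , ¬Rx) | inj₂ (¬fy , ¬Ry) =
          ⁻¹-injective (trans (sym (trans (φ-unfixed {x} ¬fx) (rep-¬R ¬Rx))) (trans φ≡ (trans (φ-unfixed {y} ¬fy) (rep-¬R ¬Ry))))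
        ... | inj₁ fx | inj₂ (¬fy , ¬Ry) =
          contradiction (shift≡⁻¹⇒R {x} fx (trans (sym (φ-fixed {x} fx)) (trans φ≡ (trans (φ-unfixed {y} ¬fy) (rep-¬R ¬Ry))))) ¬Ry
        ... | inj₂ (¬fx , ¬Rx) | inj₁ fy =
          contradiction (shift≡⁻¹⇒R {y} fy (trans (sym (φ-fixed {y} fy)) (trans (sym φ≡) (trans (φ-unfixed {x} ¬fx) (rep-¬R ¬Rx))))) ¬Rx

        r≤2∣R∖Fixed∣-via-φ : r ≤ ∣ R? ∩? ∁? fixed? ∣ + ∣ R? ∩? ∁? fixed? ∣
        r≤2∣R∖Fixed∣-via-φ = subst (_≤ ∣ R? ∩? ∁? fixed? ∣ + ∣ R? ∩? ∁? fixed? ∣) ∣U∣≡r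
          (∣∣-≤-two-to-one U? (R? ∩? ∁? fixed?) regular? φ (λ {x} _ → φ-R∖Fixed x)
            (λ {x} {y} (_ , (¬fx , Rx)) (_ , (¬fy , Ry)) φ≡ →
               trans (sym (trans (φ-unfixed {x} ¬fx) (rep-R Rx))) (trans φ≡ (trans (φ-unfixed {y} ¬fy) (rep-R Ry))))
            (λ {x} {y} (_ , ¬rx) (_ , ¬ry) → φ-injective-irregular {x} {y} ¬rx ¬ry))

      r≤2∣R∖Fixed∣ : r ≤ ∣ R? ∩? ∁? fixed? ∣ + ∣ R? ∩? ∁? fixed? ∣
      r≤2∣R∖Fixed∣ with any? fixed?
      ... | yes (_ , y₀-fixed) = r≤2∣R∖Fixed∣-via-φ y₀-fixed
      ... | no none = begin
        r                                       ≡⟨ ∣U∣≡r ⟨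
        ∣ U? ∣                                  ≤⟨ ∣∣≤2∣R∩∣ U? (λ _ _ → tt) ⟩
        ∣ R? ∩? U? ∣ + ∣ R? ∩? U? ∣             ≤⟨ +-mono-≤ R≤ R≤ ⟩
        ∣ R? ∩? ∁? fixed? ∣ + ∣ R? ∩? ∁? fixed? ∣ ∎
        where
        open ≤-Reasoning
        R≤ : ∣ R? ∩? U? ∣ ≤ ∣ R? ∩? ∁? fixed? ∣
        R≤ = ⊆⇒∣∣≤ (R? ∩? U?) (R? ∩? ∁? fixed?) (λ {x} (Rx , _) → Rx , λ fixed → none (x , fixed))

      ∣R∖Fixed∣≤3∣NonMinimal∣ : ∣ R? ∩? ∁? fixed? ∣ ≤ ∣ nonMinimal? ∣ + (∣ nonMinimal? ∣ + ∣ nonMinimal? ∣)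
      ∣R∖Fixed∣≤3∣NonMinimal∣ = +-cancelˡ-≤ f q (a + (a + a)) (begin
        f + q                   ≤⟨ ∣∣+∣∣-≤-disjoint fixed? (R? ∩? ∁? fixed?) R? proj₁ proj₁ (λ (fx , (_ , ¬fx)) → ¬fx fx) ⟩
        ∣ R? ∣                  ≤⟨ ∣∣-≤-∪ R? nonMinimal? (fixed? ∪? localMin?) split ⟩
        a + ∣ fixed? ∪? localMin? ∣ ≤⟨ +-monoʳ-≤ a (∣∣-≤-∪ (fixed? ∪? localMin?) fixed? localMin? id) ⟩
        a + (f + ∣ localMin? ∣) ≤⟨ +-monoʳ-≤ a (+-monoʳ-≤ f ∣LocalMin∣≤2∣NonMinimal∣) ⟩
        a + (f + (a + a))       ≡⟨ rearrange a f ⟩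
        f + (a + (a + a))       ∎)
        where
        open ≤-Reasoning
        a = ∣ nonMinimal? ∣
        f = ∣ fixed? ∣
        q = ∣ R? ∩? ∁? fixed? ∣
        split : R ⊆ NonMinimal ∪ (Fixed ∪ LocalMin)
        split {x} Rx with nonMinimal? x | fixed? x
        ... | yes nm | _         = inj₁ nm
        ... | no ¬nm | yes fixed = inj₂ (inj₁ fixed)
        ... | no ¬nm | no ¬fixed = inj₂ (inj₂ ((Rx , ¬nm) , ¬fixed))
        rearrange : ∀ a f → a + (f + (a + a)) ≡ f + (a + (a + a))
        rearrange = solve-∀

      r≤6∣NonMinimal∣ : r ≤ 6 * ∣ nonMinimal? ∣
      r≤6∣NonMinimal∣ = begin
        r                               ≤⟨ r≤2∣R∖Fixed∣ ⟩
        q + q                           ≤⟨ +-mono-≤ ∣R∖Fixed∣≤3∣NonMinimal∣ ∣R∖Fixed∣≤3∣NonMinimal∣ ⟩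
        (a + (a + a)) + (a + (a + a))   ≡⟨ six-times a ⟩
        6 * a                           ∎
        where
        open ≤-Reasoning
        a = ∣ nonMinimal? ∣
        q = ∣ R? ∩? ∁? fixed? ∣
        six-times : ∀ a → (a + (a + a)) + (a + (a + a)) ≡ 6 * a
        six-times = solve-∀

  periodic : Fin r → SmallFamily
  periodic h = record
    { Member     = λ S → InverseClosed G S × h ≢ ε × Periodic h S
    ; member?    = λ S → inverseClosed? S ×-dec ¬? (h Fin.≟ ε) ×-dec periodic? h S
    ; Free       = NonMinimal h
    ; free?      = nonMinimal? h
    ; Free⊆R     = proj₁
    ; determined = λ (S⁻¹ , _ , S-per) (T⁻¹ , _ , T-per) → periodic-determined h S⁻¹ S-per T⁻¹ T-per
    ; large      = λ (_ , h≢ε , _) → r≤6∣NonMinimal∣ h h≢ε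
    }

  -- Covering the bad sets

  module _ {S : Subset r} (S⁻¹ : InverseClosed G S) where

    connected : ∀ {L} {v : Vec (Fin r) L} → ⟨ Generators v ⟩ ≐ ⟨ _∈ S ⟩ →
                ¬ SmallFamily.Member (disconnected v) S → Connected G S
    connected {v = v} (⟨v⟩⊆ , ⊆⟨v⟩) ¬disconnected = ⟨⟩-universal⇒paths (λ y → ⟨v⟩⊆ (all y))
      where
      all : ∀ y → ⟨ Generators v ⟩ y
      all = decidable-stable (all? ⟨ generators? v ⟩?) (λ ¬all → ¬disconnected (S⁻¹ , (λ x x∈S → ⊆⟨v⟩ (⊆⟨⟩ x∈S)) , ¬all))

    twinFree : (∀ h → ¬ SmallFamily.Member (periodic h) S) → TwinFree G S
    twinFree ¬periodic x y twins with x Fin.≟ y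
    ... | yes x≡y = x≡y
    ... | no x≢y  = contradiction (S⁻¹ , (λ h≡ε → x≢y (x∙y⁻¹≈ε⇒x≈y x y h≡ε)) , shift) (¬periodic (x ∙ y ⁻¹))
      where
      shift : Periodic (x ∙ y ⁻¹) S
      shift u =
          (λ u∈ → subst (_∈ S) (assoc u x (y ⁻¹))
                    (proj₁ (twins (u ∙ x)) (subst (_∈ S) (sym (cancelʳ (inverseʳ x) u)) u∈)))
        , (λ u∙h∈ → subst (_∈ S) (cancelʳ (inverseʳ x) u)
                      (proj₂ (twins (u ∙ x)) (subst (_∈ S) (sym (assoc u x (y ⁻¹))) u∙h∈)))

    -- ⟨ TwoSteps ⟩ consists of the ends of even walks from ε: it has index at most 2, and
    -- a proper 2-colouring is constant on it, so it avoids S when Cay(G,S) is bipartite.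
    TwoSteps : Pred (Fin r) 0ℓ
    TwoSteps g = ∃[ s ] s ∈ S × Step (_∈ S) s g

    twoSteps? : Decidable TwoSteps
    twoSteps? g = any? (λ s → s ∈? S ×-dec g ∙ s ⁻¹ ∈? S)

    TwoSteps-⁻¹ : ⁻¹-Closed TwoSteps
    TwoSteps-⁻¹ g (s , s∈ , gs⁻¹∈) = (g ∙ s ⁻¹) ⁻¹ , S⁻¹ _ gs⁻¹∈ ,
      subst (_∈ S) (sym (begin
        g ⁻¹ ∙ ((g ∙ s ⁻¹) ⁻¹) ⁻¹   ≡⟨ cong (g ⁻¹ ∙_) (⁻¹-involutive (g ∙ s ⁻¹)) ⟩
        g ⁻¹ ∙ (g ∙ s ⁻¹)           ≡⟨ cancelˡ (inverseˡ g) (s ⁻¹) ⟩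
        s ⁻¹                        ∎)) (S⁻¹ s s∈)
      where open ≡-Reasoning

    TwoSteps⇒path : ∀ {a b} → Step TwoSteps a b → ∃[ m ] Step (_∈ S) a m × Step (_∈ S) m b
    TwoSteps⇒path {a} {b} (s , s∈ , step) = s ∙ a
      , subst (λ z → Step (_∈ S) z (s ∙ a)) (identityˡ a) (step-translate {X = _∈ S} a (Step-ε⁺ {X = _∈ S} s∈))
      , subst (Step (_∈ S) (s ∙ a)) (cancelʳ (inverseˡ a) b) (step-translate {X = _∈ S} a step)

    path⇒TwoSteps-or-odd : ∀ {a y} → Star (Step (_∈ S)) a y →
                           Star (Step TwoSteps) a y ⊎ ∃[ m ] Step (_∈ S) a m × Star (Step TwoSteps) m y
    path⇒TwoSteps-or-odd Star.ε = inj₁ Star.ε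
    path⇒TwoSteps-or-odd {a} (a-m ◅ m→y) with path⇒TwoSteps-or-odd m→y
    ... | inj₁ even              = inj₂ (_ , a-m , even)
    ... | inj₂ (_ , m-m′ , even) = inj₁ ((_ , a-m , step-translate {X = _∈ S} (a ⁻¹) m-m′) ◅ even)

    module _ (c : Fin r → Bool) (proper : ∀ x y → Adj G S x y → c x ≢ c y) where

      two-steps-same-colour : ∀ {x m y} → Step (_∈ S) x m → Step (_∈ S) m y → c x ≡ c y
      two-steps-same-colour {x} {m} {y} x-m m-y =
        trans (¬-not (proper x m x-m)) (sym (¬-not (≢-sym (proper m y m-y))))

      TwoSteps-path-same-colour : ∀ {a y} → Star (Step TwoSteps) a y → c a ≡ c y
      TwoSteps-path-same-colour Star.ε = refl
      TwoSteps-path-same-colour (step ◅ path) with TwoSteps⇒path step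
      ... | _ , a-m , m-b = trans (two-steps-same-colour a-m m-b) (TwoSteps-path-same-colour path)

      S⊥⟨TwoSteps⟩ : ∀ {x} → x ∈ S → ¬ ⟨ TwoSteps ⟩ x
      S⊥⟨TwoSteps⟩ {x} x∈S [ ε→x ] = proper ε x (Step-ε⁺ {X = _∈ S} x∈S) (TwoSteps-path-same-colour ε→x)

    module _ (S-connected : Connected G S) {s₀} (s₀∈S : s₀ ∈ S) where

      ⟨TwoSteps⟩-index≤2 : ∀ y → ⟨ TwoSteps ⟩ y ⊎ Step ⟨ TwoSteps ⟩ s₀ y
      ⟨TwoSteps⟩-index≤2 y with path⇒TwoSteps-or-odd (S-connected ε y)
      ... | inj₁ even = inj₁ [ even ]
      ... | inj₂ (m , ε-m , even) = inj₂ (subst ⟨ TwoSteps ⟩ (cancelᶜ (inverseˡ m) y (s₀ ⁻¹))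
                                             (⟨⟩-∙ (⊆⟨⟩ ms₀⁻¹∈) (path⇒Step⟨⟩ even)))
        where
        ms₀⁻¹∈ : TwoSteps (m ∙ s₀ ⁻¹)
        ms₀⁻¹∈ = s₀ ⁻¹ , S⁻¹ s₀ s₀∈S , subst (_∈ S) (sym (cancelʳ (inverseʳ (s₀ ⁻¹)) m)) (Step-ε⁻ {X = _∈ S} ε-m)

      r≤2∣⟨TwoSteps⟩∣ : r ≤ ∣ ⟨ twoSteps? ⟩? ∣ + ∣ ⟨ twoSteps? ⟩? ∣
      r≤2∣⟨TwoSteps⟩∣ = begin
        r                                          ≡⟨ ∣U∣≡r ⟨
        ∣ U? ∣                                     ≤⟨ ∣∣-≤-∪ U? ⟨ twoSteps? ⟩? coset? (λ {y} _ → ⟨TwoSteps⟩-index≤2 y) ⟩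
        ∣ ⟨ twoSteps? ⟩? ∣ + ∣ coset? ∣            ≤⟨ +-monoʳ-≤ ∣ ⟨ twoSteps? ⟩? ∣ coset≤ ⟩
        ∣ ⟨ twoSteps? ⟩? ∣ + ∣ ⟨ twoSteps? ⟩? ∣    ∎
        where
        open ≤-Reasoning
        coset? : Decidable (Step ⟨ TwoSteps ⟩ s₀)
        coset? y = ⟨ twoSteps? ⟩? (y ∙ s₀ ⁻¹)
        coset≤ : ∣ coset? ∣ ≤ ∣ ⟨ twoSteps? ⟩? ∣
        coset≤ = ∣∣-≤-injection coset? ⟨ twoSteps? ⟩? ∈-allFin (_∙ s₀ ⁻¹) id (λ _ _ → ∙-cancelʳ (s₀ ⁻¹) _ _)

    not-bipartite : ∀ {L} {w : Vec (Fin r) L} → Connected G S → ∀ {s₀} → s₀ ∈ S → ⟨ Generators w ⟩ ≐ ⟨ TwoSteps ⟩ →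
                    ¬ SmallFamily.Member (bipartite w) S → ¬ Bipartite G S
    not-bipartite {w = w} S-connected s₀∈S (⟨w⟩⊆ , ⊆⟨w⟩) ¬bipartite (c , proper) = ¬bipartite
      ( S⁻¹
      , (λ x x∈S x∈⟨w⟩ → S⊥⟨TwoSteps⟩ c proper x∈S (⟨w⟩⊆ x∈⟨w⟩))
      , subst (λ k → r ≤ k + k) (sym ∣⟨w⟩∣≡) (r≤2∣⟨TwoSteps⟩∣ S-connected s₀∈S))
      where
      ∣⟨w⟩∣≡ : ∣ ⟨ generators? w ⟩? ∣ ≡ ∣ ⟨ twoSteps? ⟩? ∣
      ∣⟨w⟩∣≡ = ≐⇒∣∣≡ ⟨ generators? w ⟩? ⟨ twoSteps? ⟩? (⟨w⟩⊆ , ⊆⟨w⟩)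

  ∈-from-nontrivial-path : ∀ {S y} → Star (Adj G S) ε y → y ≢ ε → ∃[ s ] s ∈ S
  ∈-from-nontrivial-path Star.ε        ε≢ε = contradiction refl ε≢ε
  ∈-from-nontrivial-path (ε-m ◅ _) _ = _ , Step-ε⁻ {X = _∈ _} ε-m

  data FamilyIndex (L : ℕ) : Set where
    disconnected-by bipartite-by : Vec (Fin r) L → FamilyIndex L
    periodic-by                  : Fin r → FamilyIndex L

  family : ∀ {L} → FamilyIndex L → SmallFamily
  family (disconnected-by v) = disconnected v
  family (bipartite-by v)    = bipartite v
  family (periodic-by h)     = periodic h

  familyIndices : ∀ L → List (FamilyIndex L)
  familyIndices L =
    map disconnected-by (vectors (allFin r) L) ++ (map bipartite-by (vectors (allFin r) L) ++ map periodic-by (allFin r))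

  ∈-familyIndices : ∀ {L} (i : FamilyIndex L) → i ∈ₗ familyIndices L
  ∈-familyIndices (disconnected-by v) = ∈-++⁺ˡ (∈-map⁺ disconnected-by (∈-vectors ∈-allFin v))
  ∈-familyIndices {L} (bipartite-by v) =
    ∈-++⁺ʳ (map disconnected-by (vectors (allFin r) L)) (∈-++⁺ˡ (∈-map⁺ bipartite-by (∈-vectors ∈-allFin v)))
  ∈-familyIndices {L} (periodic-by h) =
    ∈-++⁺ʳ (map disconnected-by (vectors (allFin r) L))
      (∈-++⁺ʳ (map bipartite-by (vectors (allFin r) L)) (∈-map⁺ periodic-by (∈-allFin h)))

  length-familyIndices : ∀ L → length (familyIndices L) ≡ r ^ L + (r ^ L + r)
  length-familyIndices L = begin
    length (map disconnected-by vs ++ (map bipartite-by vs ++ map periodic-by (allFin r)))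
      ≡⟨ length-++ (map disconnected-by vs) ⟩
    length (map disconnected-by vs) + length (map bipartite-by vs ++ map periodic-by (allFin r))
      ≡⟨ cong (length (map disconnected-by vs) +_) (length-++ (map bipartite-by vs)) ⟩
    length (map disconnected-by vs) + (length (map bipartite-by vs) + length (map periodic-by (allFin r)))
      ≡⟨ cong₂ _+_ (length-map disconnected-by vs) (cong₂ _+_ (length-map bipartite-by vs) (length-map periodic-by (allFin r))) ⟩
    length vs + (length vs + length (allFin r))
      ≡⟨ cong₂ (λ a b → a + (a + b)) (trans (length-vectors (allFin r) L) (cong (_^ L) ∣allFin∣)) ∣allFin∣ ⟩
    r ^ L + (r ^ L + r)
      ∎
    where
    open ≡-Reasoning
    vs = vectors (allFin r) L
    ∣allFin∣ : length (allFin r) ≡ r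
    ∣allFin∣ = length-tabulate id

  module _ {L} (r<2^L+1 : r < 2 ^ suc L) {y₁} (y₁≢ε : y₁ ≢ ε) where

    bad-covered : ∀ {S} → InverseClosed G S × ¬ Good G S → Any (λ i → SmallFamily.Member (family i) S) (familyIndices L)
    bad-covered {S} (S⁻¹ , ¬good) with Any.any? (λ i → SmallFamily.member? (family i) S) (familyIndices L)
    ... | yes covered = covered
    ... | no ¬covered = contradiction (S⁻¹ , S-connected , S-not-bipartite , S-twinFree) ¬good
      where
      ¬member : ∀ i → ¬ SmallFamily.Member (family i) S
      ¬member i m = ¬covered (Any.map (λ { refl → m }) (∈-familyIndices i))
      S-connected : Connected G S
      S-connected with generating-vector (_∈? S) S⁻¹ r<2^L+1
      ... | v , ⟨v⟩≐ = connected S⁻¹ ⟨v⟩≐ (¬member (disconnected-by v))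
      S-not-bipartite : ¬ Bipartite G S
      S-not-bipartite with generating-vector (twoSteps? S⁻¹) (TwoSteps-⁻¹ S⁻¹) r<2^L+1
                         | ∈-from-nontrivial-path (S-connected ε y₁) y₁≢ε
      ... | w , ⟨w⟩≐ | _ , s₀∈S = not-bipartite S⁻¹ S-connected s₀∈S ⟨w⟩≐ (¬member (bipartite-by w))
      S-twinFree : TwinFree G S
      S-twinFree = twinFree S⁻¹ (¬member ∘ periodic-by)

    count-bad-≤ : (bad? : Decidable (λ S → InverseClosed G S × ¬ Good G S)) (ic? : Decidable (InverseClosed G)) →
                  ∀ {κ} → (∀ {m} → r ≤ 6 * m → κ ≤ m) → count bad? * 2 ^ κ ≤ (r ^ L + (r ^ L + r)) * count ic?
    count-bad-≤ bad? ic? {κ} κ-least = begin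
      count bad? * 2 ^ κ
        ≤⟨ *-monoˡ-≤ (2 ^ κ) (Subsets.∣∣-≤-sum bad? (SmallFamily.member? ∘ family) (familyIndices L) bad-covered) ⟩
      sum (map (λ i → count (SmallFamily.member? (family i))) (familyIndices L)) * 2 ^ κ
        ≤⟨ sum-map-*-≤ _ (λ i → SmallFamily.count-bound (family i) κ-least) (familyIndices L) ⟩
      length (familyIndices L) * 2 ^ ∣ R? ∣
        ≤⟨ *-mono-≤ (≤-reflexive (length-familyIndices L)) (2^∣R∣≤count-inverseClosed ic?) ⟩
      (r ^ L + (r ^ L + r)) * count ic?   ∎
      where open ≤-Reasoning

proposition3p5 : (r : ℕ) (G : FinAbGroup r)
    → (∀ e → IsExponent G e → 2 < e)
    → (inv? : Decidable (InverseClosed G))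
    → (bad? : Decidable (λ S → InverseClosed G S × ¬ Good G S))
    → RatioBound r (count bad?) (count inv?)
proposition3p5 zero G _ _ _ = contradiction (FinAbGroup.ε G) ¬Fin0
-- The exponent hypothesis is needed only to exclude the trivial group, which has no element ≢ ε.
proposition3p5 (suc zero) G exponent>2 _ _ = contradiction (exponent>2 1 exponent-1) λ { (s≤s ()) }
  where
  exponent-1 : IsExponent G 1
  exponent-1 = s≤s z≤n , (λ _ → all-equal _ _) , (λ _ 0<m _ → 0<m)
    where
    all-equal : ∀ (x y : Fin 1) → x ≡ y
    all-equal zero zero = refl
proposition3p5 (suc (suc n)) G _ inv? bad? with ∃⌊log₂⌋ (suc n) | ∃⌈/6⌉ (suc (suc n))
... | L , 2^L≤r , r<2^L+1 | κ , r≤6κ , κ-least =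
  ratio-bound {L = L} {κ = κ} (1≤L r<2^L+1) (≤-trans (m^n>0 2 (∣ R? G ∣)) (2^∣R∣≤count-inverseClosed G inv?)) 2^L≤r r≤6κ
    (count-bad-≤ G {L} r<2^L+1 (proj₂ non-identity) bad? inv? κ-least)
  where
  1≤L : ∀ {L} → suc (suc n) < 2 ^ suc L → 1 ≤ L
  1≤L {zero}  (s≤s (s≤s ()))
  1≤L {suc L} _ = s≤s z≤n
  non-identity : ∃[ y ] y ≢ FinAbGroup.ε G
  non-identity with zero Fin.≟ FinAbGroup.ε G
  ... | yes 0≡ε = suc zero , λ 1≡ε → Fin.0≢1+n (trans 0≡ε (sym 1≡ε))
  ... | no 0≢ε  = zero , 0≢ε
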